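{- Let $n\ge 3$ be an integer. The maximum diameter of an edge-pancyclic simple graph of order $n$ having at least one edge is $\lfloor 2n/5\rfloor$. That is, every such graph has diameter at most $\lfloor 2n/5\rfloor$, and there exists such a graph with diameter exactly $\lfloor 2n/5\rfloor$.
   Context: All graphs are finite and simple. The order of a graph is its number of vertices. A $k$-cycle is a cycle of length $k$. A graph $G$ of order $n$ is called edge-pancyclic if for every integer $k$ with $3\le k\le n$, every edge of $G$ lies in a $k$-cycle of $G$. The diameter of a connected graph is the maximum distance between two of its vertices. -}

module Defs where

open import Data.Nat using (ℕ; zero; suc; _≤_; _<_)
open import Data.Fin using (Fin; zero; suc; inject₁; fromℕ)
open import Data.Bool using (Bool; true; false)
open import Data.Product using (Σ; ∃; _×_; _,_)
open import Data.Sum using (_⊎_)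
open import Relation.Binary.PropositionalEquality using (_≡_)
open import Relation.Nullary using (¬_)
open import Function.Definitions using (Injective)

record Graph (n : ℕ) : Set where
  field
    adj   : Fin n → Fin n → Bool
    sym   : ∀ u v → adj u v ≡ adj v u
    irref : ∀ v → adj v v ≡ false
open Graph public

Adj : ∀ {n} → Graph n → Fin n → Fin n → Set
Adj G u v = adj G u v ≡ true

HasEdge : ∀ {n} → Graph n → Set
HasEdge {n} G = Σ (Fin n) λ u → Σ (Fin n) λ v → Adj G u v

SamePair : ∀ {n} → Fin n → Fin n → Fin n → Fin n → Set
SamePair a b u v = (a ≡ u × b ≡ v) ⊎ (a ≡ v × b ≡ u)

-- A cycle of length (suc m): distinct vertices c 0, …, c m with c j ~ c (j+1) and c m ~ c 0.
record Cycle {n : ℕ} (G : Graph n) (m : ℕ) : Set where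
  field
    vtx      : Fin (suc m) → Fin n
    distinct : Injective _≡_ _≡_ vtx
    steps    : ∀ (j : Fin m) → Adj G (vtx (inject₁ j)) (vtx (suc j))
    closing  : Adj G (vtx (fromℕ m)) (vtx zero)
open Cycle public

EdgeInCycle : ∀ {n} {G : Graph n} {m} → Cycle G m → Fin n → Fin n → Set
EdgeInCycle {m = m} C u v =
  (Σ (Fin m) λ j → SamePair (vtx C (inject₁ j)) (vtx C (suc j)) u v)
  ⊎ SamePair (vtx C (fromℕ m)) (vtx C zero) u v

EdgePancyclic : ∀ {n} → Graph n → Set
EdgePancyclic {n} G =
  ∀ (m : ℕ) → 3 ≤ suc m → suc m ≤ n →
  ∀ (u v : Fin n) → Adj G u v →
  Σ (Cycle G m) λ C → EdgeInCycle C u v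

record Walk {n : ℕ} (G : Graph n) (ℓ : ℕ) (u v : Fin n) : Set where
  field
    wv    : Fin (suc ℓ) → Fin n
    start : wv zero ≡ u
    end   : wv (fromℕ ℓ) ≡ v
    wstep : ∀ (j : Fin ℓ) → Adj G (wv (inject₁ j)) (wv (suc j))

DistAtMost : ∀ {n} → Graph n → Fin n → Fin n → ℕ → Set
DistAtMost G u v d = Σ ℕ λ ℓ → ℓ ≤ d × Walk G ℓ u v

HasDiameter : ∀ {n} → Graph n → ℕ → Set
HasDiameter {n} G D =
  (∀ (u v : Fin n) → DistAtMost G u v D)
  × Σ (Fin n) λ u → Σ (Fin n) λ v → ∀ (ℓ : ℕ) → Walk G ℓ u v → D ≤ ℓ

-- Let p, q realise the diameter D and sort the vertices into layers by their
-- distance to q.  The Hamiltonian path joining the ends of an edge passes through p and q, so by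
-- the discrete intermediate value theorem it meets every layer 0 < i < D away from its ends: such
-- a layer has at least two vertices, and at least three if it contains an edge.  Every edge lies
-- in a triangle, so an edge from layer i + 1 down to layer i forces an edge inside one of the two
-- layers.  Hence two consecutive layers hold at least five vertices (four at either end), and
-- summing over the layers gives 5D ≤ 2n.
--
-- K₃, K₅ minus an edge and an 8-vertex graph realise the diameters 1, 2 and 3.
-- Gluing a 5-vertex gadget at vertex 0 (a triangle joined to 0, an apex over the triangle, and a
-- mirror of 0 joined to the triangle and to the neighbours of 0) adds 5 vertices and 2 to the
-- diameter while keeping every edge on paths of all lengths, and adding a true twin of a vertex
-- adds one vertex without changing the diameter.  This realises every d with 5d ≤ 2n.

{-# OPTIONS --safe #-}
module Submission where

open import Defs
open import Data.Nat using (ℕ; NonZero; zero; suc; _+_; _∸_; _*_; _/_; _≤_; _<_; _≤?_; z≤n; s≤s) renaming (_≟_ to _≟ℕ_)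
open import Data.Nat.Properties using (suc-injective; ≤-refl; ≤-trans; ≤-antisym; ≤-pred; <-irrefl; n≤1+n; ≮⇒≥; n≤0⇒n≡0; anyUpTo?; allUpTo?; ≤-reflexive; ≰⇒>; 1+n≰n; m≤m+n; m+[n∸m]≡n; m+n∸m≡n; ∸-monoˡ-≤; +-identityʳ; +-mono-≤; +-monoˡ-≤; +-monoʳ-≤; *-monoʳ-≤; *-comm; +-comm; +-suc; m≤n+m; +-cancelˡ-≤; ≤-total; <⇒≤; m≤n⇒m<n∨m≡n; <⇒≱; module ≤-Reasoning)
open import Data.Nat.Solver using (module +-*-Solver)
open +-*-Solver using (solve; _:+_; _:*_; con; _:=_)
open import Data.Nat.Induction using (<-rec)
open import Data.Nat.DivMod using (m*n/n≡m; /-monoˡ-≤; m/n*n≤m; m≥n⇒m/n>0)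
open import Data.Bool using (Bool; true; false; if_then_else_; _∧_; _∨_; not)
open import Data.Bool.Properties using (∧-identityʳ; ∨-zeroʳ)
import Data.Bool as Bool
open import Data.Fin using (Fin; zero; suc; inject₁; fromℕ; _≟_; #_)
open import Data.Fin.Properties using (injective⇒≤; any?; all?)
import Data.Fin.Properties as Fin
open import Data.Fin.Permutation.Components using (transpose; transpose-inverse)
open import Data.List using (List; []; _∷_; _++_; _∷ʳ_; length; map; reverse; tabulate; allFin; cartesianProduct; concatMap; filter; lookup)
open import Data.List.Extrema.Nat using (argmax; f[xs]≤f[argmax])
open import Data.List.Properties using (length-++; length-map; map-++; length-reverse; length-tabulate; unfold-reverse)
open import Data.List.Membership.Propositional using (_∈_; _∉_)
open import Data.List.Membership.Propositional.Properties using (∈-++⁺ˡ; ∈-++⁺ʳ; ∈-++⁻; ∈-map⁺; ∈-map⁻; ∈-allFin; ∈-cartesianProduct⁺)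
open import Data.List.Relation.Unary.Any as Any using (Any; here; there)
open import Data.List.Relation.Unary.All as All using (All; []; _∷_)
open import Data.List.Relation.Unary.All.Properties using (¬Any⇒All¬; All¬⇒¬Any)
open import Data.List.Relation.Unary.AllPairs using ([]; _∷_)
open import Data.List.Relation.Unary.Unique.Propositional using (Unique)
import Data.List.Relation.Unary.Unique.Propositional.Properties as Unique
open import Data.List.Relation.Binary.Permutation.Setoid.Properties using (Unique-resp-↭)
open import Data.List.Relation.Binary.Disjoint.Propositional using (Disjoint)
open import Data.List.Relation.Binary.Permutation.Propositional using (_↭_; ↭-sym; ↭⇒↭ₛ)
open import Data.List.Relation.Binary.Permutation.Propositional.Properties using (↭-reverse; ++-comm; shifts; ↭-length; ∈-resp-↭)
open import Relation.Nullary.Decidable using (_×-dec_; _⊎-dec_; _→-dec_; ¬?; does; dec-false; dec-true; True; toWitness)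
open import Data.Product using (Σ; ∃; _×_; _,_; proj₁; proj₂; uncurry)
open import Data.Sum using (_⊎_; inj₁; inj₂)
open import Data.Empty using (⊥-elim)
open import Data.Unit using (⊤; tt)
open import Relation.Nullary using (¬_; Dec; yes; no)
open import Relation.Binary.PropositionalEquality as ≡ using (_≡_; _≢_; refl; cong; cong₂; subst; subst₂)
open import Function using (_∘_)
open import Function.Definitions using (Injective)

variable
  n m k ℓ : ℕ

module _ {A : Set} where

  unique-resp-↭ : {xs ys : List A} → xs ↭ ys → Unique xs → Unique ys
  unique-resp-↭ p = Unique-resp-↭ (≡.setoid A) (↭⇒↭ₛ p)

  unique-reverse : {xs : List A} → Unique xs → Unique (reverse xs)
  unique-reverse {xs} = unique-resp-↭ (↭-sym (↭-reverse xs))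

  unique-++-comm : (xs ys : List A) → Unique (xs ++ ys) → Unique (ys ++ xs)
  unique-++-comm xs ys = unique-resp-↭ (++-comm xs ys)

  -- lookup indexed by Fin (suc m) rather than Fin (length xs), as the vertices of a Cycle are.
  lookupAt : (xs : List A) → length xs ≡ suc m → Fin (suc m) → A
  lookupAt (x ∷ xs) e zero = x
  lookupAt {suc m} (x ∷ xs) e (suc i) = lookupAt xs (suc-injective e) i

  lookupAt-∈ : (xs : List A) (e : length xs ≡ suc m) (i : Fin (suc m)) → lookupAt xs e i ∈ xs
  lookupAt-∈ (x ∷ xs) e zero = here refl
  lookupAt-∈ {suc m} (x ∷ xs) e (suc i) = there (lookupAt-∈ xs (suc-injective e) i)

  lookupAt-injective : (xs : List A) (e : length xs ≡ suc m) → Unique xs → Injective _≡_ _≡_ (lookupAt xs e)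
  lookupAt-injective (x ∷ xs) e u {zero} {zero} _ = refl
  lookupAt-injective {suc m} (x ∷ xs) e (x∉ ∷ u) {zero} {suc j} x≡ =
    ⊥-elim (All¬⇒¬Any x∉ (subst (_∈ xs) (≡.sym x≡) (lookupAt-∈ xs (suc-injective e) j)))
  lookupAt-injective {suc m} (x ∷ xs) e (x∉ ∷ u) {suc i} {zero} ≡x =
    ⊥-elim (All¬⇒¬Any x∉ (subst (_∈ xs) ≡x (lookupAt-∈ xs (suc-injective e) i)))
  lookupAt-injective {suc m} (x ∷ xs) e (_ ∷ u) {suc i} {suc j} eq =
    cong suc (lookupAt-injective xs (suc-injective e) u eq)

unique-length⇒complete : {xs : List (Fin n)} → Unique xs → length xs ≡ n → ∀ z → z ∈ xs
unique-length⇒complete {xs = xs} u e z with Any.any? (z ≟_) xs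
... | yes z∈xs = z∈xs
... | no z∉xs = ⊥-elim (<-irrefl refl (injective⇒≤ (lookupAt-injective (z ∷ xs) (cong suc e) (¬Any⇒All¬ xs z∉xs ∷ u))))

unique-∷ʳ⇒∉ : {A : Set} {xs : List A} {x : A} → Unique (xs ∷ʳ x) → x ∉ xs
unique-∷ʳ⇒∉ {xs = y ∷ xs} (y∉ ∷ _) (here refl) = All¬⇒¬Any y∉ (∈-++⁺ʳ xs (here refl))
unique-∷ʳ⇒∉ {xs = y ∷ xs} (_ ∷ u) (there x∈) = unique-∷ʳ⇒∉ u x∈

∈-∷⁻ : {A : Set} {x z : A} {xs : List A} → z ∈ x ∷ xs → z ≢ x → z ∈ xs
∈-∷⁻ (here z≡x) z≢x = ⊥-elim (z≢x z≡x)
∈-∷⁻ (there z∈) _ = z∈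

∈-∷ʳ⁻ : {A : Set} {x z : A} {xs : List A} → z ∈ xs ∷ʳ x → z ≢ x → z ∈ xs
∈-∷ʳ⁻ {xs = xs} z∈ z≢x with ∈-++⁻ xs z∈
... | inj₁ z∈xs = z∈xs
... | inj₂ (here z≡x) = ⊥-elim (z≢x z≡x)

zero∉map-suc : ∀ (xs : List (Fin n)) → _∉_ {A = Fin (suc n)} zero (map suc xs)
zero∉map-suc (x ∷ xs) (here ())
zero∉map-suc (x ∷ xs) (there z∈) = zero∉map-suc xs z∈

does-≟-comm : (x y : Fin k) → does (x ≟ y) ≡ does (y ≟ x)
does-≟-comm x y with x ≟ y
... | yes refl = ≡.sym (dec-true (x ≟ x) refl)
... | no x≢y = ≡.sym (dec-false (y ≟ x) (x≢y ∘ ≡.sym))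

does-≟-injective : {f : Fin k → Fin k} → Injective _≡_ _≡_ f → ∀ x y → does (f x ≟ f y) ≡ does (x ≟ y)
does-≟-injective {f = f} f-inj x y with x ≟ y
... | yes refl = dec-true (f x ≟ f x) refl
... | no x≢y = dec-false (f x ≟ f y) (x≢y ∘ f-inj)

Least : (ℕ → Set) → Set
Least P = ∃ λ m → P m × (∀ {j} → j < m → ¬ P j)

least : {P : ℕ → Set} → (∀ k → Dec (P k)) → ∀ k → P k → Least P
least {P} P? = <-rec (λ k → P k → Least P) search
  where
  search : ∀ k → (∀ {j} → j < k → P j → Least P) → P k → Least P
  search k smaller pk with anyUpTo? P? k
  ... | yes (j , j<k , pj) = smaller j<k pj
  ... | no none = k , pk , λ j<k pj → none (_ , j<k , pj)

*≤⇒≤/ : ∀ d k m .{{_ : NonZero k}} → d * k ≤ m → d ≤ m / k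
*≤⇒≤/ d k m dk≤m = subst (_≤ m / k) (m*n/n≡m d k) (/-monoˡ-≤ k dk≤m)

half-≤ : ∀ a b → 2 * a ≤ suc (2 * b) → a ≤ b
half-≤ a b 2a≤1+2b with a ≤? b
... | yes a≤b = a≤b
... | no a≰b = ⊥-elim (1+n≰n (≤-trans (≤-reflexive (double-suc b)) (≤-trans (*-monoʳ-≤ 2 (≰⇒> a≰b)) 2a≤1+2b)))
  where
  double-suc : ∀ b → suc (suc (2 * b)) ≡ 2 * suc b
  double-suc = solve 1 (λ b → con 2 :+ con 2 :* b := con 2 :* (con 1 :+ b)) refl

module _ {P : ℕ → Set} where

  range-empty : ∀ {a} → ∀ k → suc a ≤ k → k ≤ a → P k
  range-empty k a<k k≤a = ⊥-elim (<-irrefl refl (≤-trans a<k k≤a))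

  range-step : ∀ {a b} → (∀ k → a ≤ k → k ≤ b → P k) → P (suc b) → ∀ k → a ≤ k → k ≤ suc b → P k
  range-step below top k a≤k k≤1+b with m≤n⇒m<n∨m≡n k≤1+b
  ... | inj₁ (s≤s k≤b) = below k a≤k k≤b
  ... | inj₂ refl = top

  range-join : ∀ {a b a′ c} → (∀ k → a ≤ k → k ≤ b → P k) → (∀ k → a′ ≤ k → k ≤ c → P k) → a′ ≤ suc b →
               ∀ k → a ≤ k → k ≤ c → P k
  range-join {b = b} low high a′≤1+b k a≤k k≤c with k ≤? b
  ... | yes k≤b = low k a≤k k≤b
  ... | no k≰b = high k (≤-trans a′≤1+b (≰⇒> k≰b)) k≤c

  range-shift : ∀ s {a b} → (∀ L → a ≤ L → L ≤ b → P (s + L)) → ∀ k → s + a ≤ k → k ≤ s + b → P k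
  range-shift s {a} {b} shifted k s+a≤k k≤s+b =
    subst P (m+[n∸m]≡n (≤-trans (m≤m+n s a) s+a≤k))
      (shifted (k ∸ s) (subst (_≤ k ∸ s) (m+n∸m≡n s a) (∸-monoˡ-≤ s s+a≤k))
                       (subst (k ∸ s ≤_) (m+n∸m≡n s b) (∸-monoˡ-≤ s k≤s+b)))

count : (Fin k → Bool) → ℕ
count {zero} f = 0
count {suc k} f = (if f zero then 1 else 0) + count (λ x → f (suc x))

count-remove : (f : Fin k → Bool) {a : Fin k} → f a ≡ true →
               count f ≡ suc (count λ x → f x ∧ not (does (x ≟ a)))
count-remove {suc k} f {zero} fa rewrite fa = cong suc (count-cong λ x → ≡.sym (∧-identityʳ (f (suc x))))
  where
  count-cong : ∀ {k} {g h : Fin k → Bool} → (∀ x → g x ≡ h x) → count g ≡ count h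
  count-cong {zero} eq = refl
  count-cong {suc k} eq = cong₂ _+_ (cong (λ b → if b then 1 else 0) (eq zero)) (count-cong (λ x → eq (suc x)))
count-remove {suc k} f {suc a} fa with f zero
... | true = cong suc (count-remove (λ x → f (suc x)) fa)
... | false = count-remove (λ x → f (suc x)) fa

unique⇒length≤count : (f : Fin k → Bool) {xs : List (Fin k)} → Unique xs → All (λ x → f x ≡ true) xs → length xs ≤ count f
unique⇒length≤count f [] [] = z≤n
unique⇒length≤count f {x ∷ xs} (x∉ ∷ u) (fx ∷ fxs) rewrite count-remove f fx =
  s≤s (unique⇒length≤count _ u (All.zipWith keep (x∉ , fxs)))
  where
  keep : ∀ {y} → x ≢ y × f y ≡ true → f y ∧ not (does (y ≟ x)) ≡ true
  keep {y} (x≢y , fy) rewrite fy | dec-false (y ≟ x) (x≢y ∘ ≡.sym) = refl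

sumBelow : ℕ → (ℕ → ℕ) → ℕ
sumBelow zero g = 0
sumBelow (suc K) g = sumBelow K g + g K

sumBelow-+ : ∀ K (g h : ℕ → ℕ) → sumBelow K (λ i → g i + h i) ≡ sumBelow K g + sumBelow K h
sumBelow-+ zero g h = refl
sumBelow-+ (suc K) g h rewrite sumBelow-+ K g h = +-exchange (sumBelow K g) (sumBelow K h) (g K) (h K)
  where
  +-exchange : ∀ a b c d → (a + b) + (c + d) ≡ (a + c) + (b + d)
  +-exchange = solve 4 (λ a b c d → (a :+ b) :+ (c :+ d) := (a :+ c) :+ (b :+ d)) refl

sumBelow-indicator-vanishes : ∀ K {c} → K ≤ c → sumBelow K (λ i → if does (c ≟ℕ i) then 1 else 0) ≡ 0
sumBelow-indicator-vanishes zero _ = refl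
sumBelow-indicator-vanishes (suc K) {c} K<c rewrite dec-false (c ≟ℕ K) (λ c≡K → <-irrefl (≡.sym c≡K) K<c) =
  ≡.trans (+-identityʳ _) (sumBelow-indicator-vanishes K (≤-trans (n≤1+n K) K<c))

sumBelow-indicator≤1 : ∀ K c → sumBelow K (λ i → if does (c ≟ℕ i) then 1 else 0) ≤ 1
sumBelow-indicator≤1 zero c = z≤n
sumBelow-indicator≤1 (suc K) c with c ≟ℕ K
... | no c≢K rewrite dec-false (c ≟ℕ K) c≢K | +-identityʳ (sumBelow K λ i → if does (c ≟ℕ i) then 1 else 0) =
  sumBelow-indicator≤1 K c
... | yes refl rewrite dec-true (c ≟ℕ c) refl | sumBelow-indicator-vanishes c ≤-refl = ≤-refl

sumBelow-fibres≤ : ∀ K (h : Fin k → ℕ) → sumBelow K (λ i → count λ x → does (h x ≟ℕ i)) ≤ k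
sumBelow-fibres≤ {zero} K h = ≤-reflexive (sumBelow-zero K)
  where
  sumBelow-zero : ∀ K → sumBelow K (λ _ → 0) ≡ 0
  sumBelow-zero zero = refl
  sumBelow-zero (suc K) = ≡.trans (+-identityʳ _) (sumBelow-zero K)
sumBelow-fibres≤ {suc k} K h rewrite sumBelow-+ K (λ i → if does (h zero ≟ℕ i) then 1 else 0) (λ i → count λ x → does (h (suc x) ≟ℕ i)) =
  +-mono-≤ (sumBelow-indicator≤1 K (h zero)) (sumBelow-fibres≤ K (λ x → h (suc x)))

module _ (c : ℕ → ℕ) (D : ℕ) (c₀≥1 : 1 ≤ c 0) (c₀₁≥4 : 4 ≤ c 0 + c 1)
         (inner≥5 : ∀ i → 1 ≤ i → 2 + i ≤ D → 5 ≤ c i + c (suc i)) where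

  private
    double-split : ∀ s y → 2 * (s + y) ≡ 2 * s + 2 * y
    double-split = solve 2 (λ s y → con 2 :* (s :+ y) := con 2 :* s :+ con 2 :* y) refl

  sumBelow-pairs : ∀ j → 1 ≤ j → j < D → 5 * j + c j ≤ 2 * sumBelow (suc j) c
  sumBelow-pairs (suc zero) _ _ = begin
    5 + c 1                 ≤⟨ +-monoˡ-≤ (c 1) (+-mono-≤ c₀≥1 c₀₁≥4) ⟩
    c 0 + (c 0 + c 1) + c 1 ≡⟨ solve 2 (λ a b → a :+ (a :+ b) :+ b := con 2 :* (con 0 :+ a :+ b)) refl (c 0) (c 1) ⟩
    2 * (0 + c 0 + c 1)     ∎
    where open ≤-Reasoning
  sumBelow-pairs (suc (suc j)) _ j<D = begin
    5 * suc (suc j) + y       ≡⟨ solve 2 (λ j y → con 5 :* (con 2 :+ j) :+ y := con 5 :* (con 1 :+ j) :+ con 5 :+ y) refl j y ⟩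
    5 * suc j + 5 + y         ≤⟨ +-monoˡ-≤ y (+-monoʳ-≤ (5 * suc j) (inner≥5 (suc j) (s≤s z≤n) j<D)) ⟩
    5 * suc j + (x + y) + y   ≡⟨ solve 3 (λ j x y → con 5 :* (con 1 :+ j) :+ (x :+ y) :+ y := con 5 :* (con 1 :+ j) :+ x :+ con 2 :* y) refl j x y ⟩
    5 * suc j + x + 2 * y     ≤⟨ +-monoˡ-≤ (2 * y) (sumBelow-pairs (suc j) (s≤s z≤n) (≤-trans (n≤1+n _) j<D)) ⟩
    2 * S + 2 * y             ≡⟨ ≡.sym (double-split S y) ⟩
    2 * (S + y)               ∎
    where
    open ≤-Reasoning
    x y S : ℕ
    x = c (suc j)
    y = c (suc (suc j))
    S = sumBelow (suc (suc j)) c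

  five-halves-bound : ∀ D′ → D ≡ suc D′ → 1 ≤ D′ → 4 ≤ c D′ + c D → 1 ≤ c D → 5 * D ≤ 2 * sumBelow (suc D) c
  five-halves-bound D′ refl D′≥1 last≥4 c_D≥1 = begin
    5 * suc D′                  ≡⟨ solve 1 (λ j → con 5 :* (con 1 :+ j) := con 5 :* j :+ con 4 :+ con 1) refl D′ ⟩
    5 * D′ + 4 + 1              ≤⟨ +-mono-≤ (+-monoʳ-≤ (5 * D′) last≥4) c_D≥1 ⟩
    5 * D′ + (c D′ + y) + y     ≡⟨ solve 3 (λ j x y → con 5 :* j :+ (x :+ y) :+ y := con 5 :* j :+ x :+ con 2 :* y) refl D′ (c D′) y ⟩
    5 * D′ + c D′ + 2 * y       ≤⟨ +-monoˡ-≤ (2 * y) (sumBelow-pairs D′ D′≥1 ≤-refl) ⟩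
    2 * S + 2 * y               ≡⟨ ≡.sym (double-split S y) ⟩
    2 * (S + y)                 ∎
    where
    open ≤-Reasoning
    y S : ℕ
    y = c (suc D′)
    S = sumBelow (suc D′) c

-- Walks and paths

adj-sym : (G : Graph n) {x y : Fin n} → Adj G x y → Adj G y x
adj-sym G {x} {y} = ≡.trans (Graph.sym G y x)

adj-irrefl : (G : Graph n) {x : Fin n} → ¬ Adj G x x
adj-irrefl G {x} a with ≡.trans (≡.sym (irref G x)) a
... | ()

adj⇒≢ : (G : Graph n) {x y : Fin n} → Adj G x y → x ≢ y
adj⇒≢ G a refl = adj-irrefl G a

data IsWalk (G : Graph n) : Fin n → Fin n → List (Fin n) → Set where
  [_] : ∀ x → IsWalk G x x (x ∷ [])
  _∷_ : ∀ {x y z ys} → Adj G x y → IsWalk G y z ys → IsWalk G x z (x ∷ ys)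

module _ {G : Graph n} where

  isWalk-++ : ∀ {x y y′ z xs ys} → IsWalk G x y xs → Adj G y y′ → IsWalk G y′ z ys → IsWalk G x z (xs ++ ys)
  isWalk-++ [ x ] a w = a ∷ w
  isWalk-++ (b ∷ v) a w = b ∷ isWalk-++ v a w

  isWalk-reverse : ∀ {x y xs} → IsWalk G x y xs → IsWalk G y x (reverse xs)
  isWalk-reverse [ x ] = [ x ]
  isWalk-reverse {x} (_∷_ {ys = ys} a w) rewrite unfold-reverse x ys = isWalk-++ (isWalk-reverse w) (adj-sym G a) [ x ]

  isWalk-first∈ : ∀ {x y xs} → IsWalk G x y xs → x ∈ xs
  isWalk-first∈ [ x ] = here refl
  isWalk-first∈ (a ∷ w) = here refl

isWalk-unsnoc : ∀ {G : Graph n} {y b ys} → IsWalk G y b ys →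
                ys ≡ b ∷ [] ⊎ ∃ λ mid → ∃ λ c → ys ≡ mid ∷ʳ b × IsWalk G y c mid
isWalk-unsnoc [ _ ] = inj₁ refl
isWalk-unsnoc {y = y} (a ∷ w) with isWalk-unsnoc w
... | inj₁ refl = inj₂ (y ∷ [] , y , refl , [ y ])
... | inj₂ (mid , c , refl , w′) = inj₂ (y ∷ mid , c , refl , a ∷ w′)

record Path (G : Graph n) (x y : Fin n) (k : ℕ) : Set where
  constructor path
  field
    vertices : List (Fin n)
    walk     : IsWalk G x y vertices
    unique   : Unique vertices
    size     : length vertices ≡ k

PathVia : (G : Graph n) → Fin n → Fin n → ℕ → Fin n → Set
PathVia G x y k v = Σ (Path G x y k) λ P → v ∈ Path.vertices P

PathThrough : (G : Graph n) → Fin n → Fin n → ℕ → List (Fin n) → Set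
PathThrough G x y k S = Σ (Path G x y k) λ P → ∀ {v} → v ∈ S → v ∈ Path.vertices P

pathThrough⇒pathVia : ∀ {G : Graph n} {x y S v} → PathThrough G x y k S → v ∈ S → PathVia G x y k v
pathThrough⇒pathVia (P , S⊆P) v∈S = P , S⊆P v∈S

PathPancyclic : Graph n → Set
PathPancyclic {n} G = ∀ {x y} → Adj G x y → ∀ k → 3 ≤ k → k ≤ n → Path G x y k

module _ {G : Graph n} where

  reversePath : ∀ {x y} → Path G x y k → Path G y x k
  reversePath (path xs w u s) = path (reverse xs) (isWalk-reverse w) (unique-reverse u) (≡.trans (length-reverse xs) s)

  reversePathVia : ∀ {x y v} → PathVia G x y k v → PathVia G y x k v
  reversePathVia (P , v∈) = reversePath P , ∈-resp-↭ (↭-sym (↭-reverse (Path.vertices P))) v∈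

  orientPath : ∀ {x y a b} → SamePair y x a b → Path G x y k → Path G a b k
  orientPath (inj₁ (refl , refl)) = reversePath
  orientPath (inj₂ (refl , refl)) P = P

  hamiltonianPath-complete : ∀ {x y} (P : Path G x y n) → ∀ z → z ∈ Path.vertices P
  hamiltonianPath-complete (path _ _ u s) = unique-length⇒complete u s

module _ {G : Graph n} where

  isWalk-split-at : ∀ {a b xs z} → IsWalk G a b xs → z ∈ xs → z ≢ b →
    ∃ λ pre → ∃ λ post → ∃ λ y → xs ≡ (pre ∷ʳ z) ++ post × IsWalk G a z (pre ∷ʳ z) × Adj G z y × IsWalk G y b post
  isWalk-split-at [ _ ] (here refl) z≢b = ⊥-elim (z≢b refl)
  isWalk-split-at (_∷_ {ys = ys} xy w) (here refl) _ = [] , ys , _ , refl , [ _ ] , xy , w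
  isWalk-split-at (_∷_ {x = x} xy w) (there z∈) z≢b with isWalk-split-at w z∈ z≢b
  ... | pre , post , y , refl , w₁ , zy , w₂ = x ∷ pre , post , y , refl , xy ∷ w₁ , zy , w₂

  prependPath : ∀ {c x y} → Adj G c x → (P : Path G x y k) → c ∉ Path.vertices P → Path G c y (suc k)
  prependPath cx (path xs w u s) c∉ = path (_ ∷ xs) (cx ∷ w) (¬Any⇒All¬ xs c∉ ∷ u) (cong suc s)

  pathOrEdge : PathPancyclic G → ∀ {x y} → Adj G x y → ∀ k → 2 ≤ k → k ≤ n → Path G x y k
  pathOrEdge pancyclic xy k 2≤k k≤n with m≤n⇒m<n∨m≡n 2≤k
  ... | inj₁ 3≤k = pancyclic xy k 3≤k k≤n
  ... | inj₂ refl = path (_ ∷ _ ∷ []) (xy ∷ [ _ ]) ((adj⇒≢ G xy ∷ []) ∷ [] ∷ []) refl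

record Embedding (G : Graph n) (H : Graph m) : Set where
  field
    vertex    : Fin n → Fin m
    injective : Injective _≡_ _≡_ vertex
    adjacent  : ∀ {x y} → Adj G x y → Adj H (vertex x) (vertex y)

module _ {G : Graph n} {H : Graph m} (e : Embedding G H) where
  open Embedding e

  isWalk-map : ∀ {x y xs} → IsWalk G x y xs → IsWalk H (vertex x) (vertex y) (map vertex xs)
  isWalk-map [ x ] = [ vertex x ]
  isWalk-map (a ∷ w) = adjacent a ∷ isWalk-map w

  mapPath : ∀ {x y} → Path G x y k → Path H (vertex x) (vertex y) k
  mapPath (path xs w u s) = path (map vertex xs) (isWalk-map w) (Unique.map⁺ injective u) (≡.trans (length-map vertex xs) s)

  mapPathVia : ∀ {x y v} → PathVia G x y k v → PathVia H (vertex x) (vertex y) k (vertex v)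
  mapPathVia (P , v∈) = mapPath P , ∈-map⁺ vertex v∈

module _ {G : Graph n} {H : Graph m} (e : Embedding G H) where
  open Embedding e

  Fresh : List (Fin m) → Set
  Fresh S = ∀ {v} → v ∈ S → ∀ x → v ≢ vertex x

  private
    fresh-disjoint : ∀ {S} xs → Fresh S → Disjoint S (map vertex xs)
    fresh-disjoint xs fresh (v∈S , v∈xs) with ∈-map⁻ vertex v∈xs
    ... | x , _ , v≡ = fresh v∈S x v≡

  appendPath : ∀ {a b s t j} (P : Path G a b k) → Adj H (vertex b) s → (T : Path H s t j) → Fresh (Path.vertices T) →
               Σ (Path H (vertex a) t (j + k)) λ Q → Path.vertices Q ≡ map vertex (Path.vertices P) ++ Path.vertices T
  appendPath {k} {j = j} (path xs w u s) bs (path S wS uS sS) fresh =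
    path (map vertex xs ++ S) (isWalk-++ (isWalk-map e w) bs wS)
         (unique-++-comm S (map vertex xs) (Unique.++⁺ uS (Unique.map⁺ injective u) (fresh-disjoint xs fresh)))
         size ,
    refl
    where
    size : length (map vertex xs ++ S) ≡ j + k
    size = ≡.trans (length-++ (map vertex xs)) (≡.trans (cong₂ _+_ (≡.trans (length-map vertex xs) s) sS) (+-comm k j))

  insertAfter : ∀ {a b z s t j} → PathVia G a b k z → z ≢ b → Adj H (vertex z) s → (S : Path H s t j) →
                (∀ {y} → Adj G z y → Adj H t (vertex y)) → Fresh (Path.vertices S) →
                PathThrough H (vertex a) (vertex b) (j + k) (Path.vertices S)
  insertAfter {k} {z = z} (path xs w u s , z∈) z≢b zs (path S wS uS sS) ty fresh with isWalk-split-at w z∈ z≢b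
  ... | pre , post , y , refl , w₁ , zy , w₂ =
    path (U ++ S ++ W) (isWalk-++ (isWalk-map e w₁) zs (isWalk-++ wS (ty zy) (isWalk-map e w₂)))
         (unique-resp-↭ (↭-sym (shifts U S)) (Unique.++⁺ uS uUW (subst (Disjoint S) map-UW (fresh-disjoint (pre ∷ʳ z ++ post) fresh))))
         (≡.trans (↭-length (shifts U S)) (≡.trans (length-++ S) (cong₂ _+_ sS (≡.trans length-UW s)))) ,
    λ v∈S → ∈-++⁺ʳ U (∈-++⁺ˡ v∈S)
    where
    U W : List (Fin m)
    U = map vertex (pre ∷ʳ z)
    W = map vertex post
    map-UW : map vertex (pre ∷ʳ z ++ post) ≡ U ++ W
    map-UW = map-++ vertex (pre ∷ʳ z) post
    uUW : Unique (U ++ W)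
    uUW = subst Unique map-UW (Unique.map⁺ injective u)
    length-UW : length (U ++ W) ≡ length (pre ∷ʳ z ++ post)
    length-UW = ≡.trans (cong length (≡.sym map-UW)) (length-map vertex (pre ∷ʳ z ++ post))

  insertAt : ∀ {a b z s t j} → a ≢ b → PathVia G a b k z → Adj H (vertex z) s → (S : Path H s t j) →
             (∀ {y} → Adj G z y → Adj H t (vertex y)) → Fresh (Path.vertices S) →
             PathThrough H (vertex a) (vertex b) (j + k) (Path.vertices S)
  insertAt {b = b} {z = z} a≢b P zs S ty fresh with z ≟ b
  ... | no z≢b = insertAfter P z≢b zs S ty fresh
  ... | yes refl with insertAfter (reversePathVia P) (a≢b ∘ ≡.sym) zs S ty fresh
  ...   | Q , S⊆Q = reversePath Q , λ v∈S → ∈-resp-↭ (↭-sym (↭-reverse (Path.vertices Q))) (S⊆Q v∈S)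

tabulate-split : {A : Set} (f : Fin (suc m) → A) (j : Fin m) →
  ∃ λ P → ∃ λ Q → tabulate f ≡ (P ∷ʳ f (inject₁ j)) ++ (f (suc j) ∷ Q)
tabulate-split {suc m} f zero = [] , tabulate (λ i → f (suc (suc i))) , refl
tabulate-split {suc m} f (suc j) with tabulate-split (λ i → f (suc i)) j
... | P , Q , eq = f zero ∷ P , Q , cong (f zero ∷_) eq

module _ {G : Graph n} where

  isWalk-tabulate : (f : Fin (suc m) → Fin n) → (∀ j → Adj G (f (inject₁ j)) (f (suc j))) →
                    IsWalk G (f zero) (f (fromℕ m)) (tabulate f)
  isWalk-tabulate {zero} f steps = [ f zero ]
  isWalk-tabulate {suc m} f steps = steps zero ∷ isWalk-tabulate (λ i → f (suc i)) (λ j → steps (suc j))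

  isWalk-split : ∀ {x y a b} P Q → IsWalk G x y ((P ∷ʳ a) ++ (b ∷ Q)) →
                 IsWalk G x a (P ∷ʳ a) × Adj G a b × IsWalk G b y (b ∷ Q)
  isWalk-split [] Q (ab ∷ w@([ _ ])) = [ _ ] , ab , w
  isWalk-split [] Q (ab ∷ w@(_ ∷ _)) = [ _ ] , ab , w
  isWalk-split (p ∷ []) Q (a ∷ w) with isWalk-split [] Q w
  ... | w₁ , ab , w₂ = a ∷ w₁ , ab , w₂
  isWalk-split (p ∷ P@(_ ∷ _)) Q (a ∷ w) with isWalk-split P Q w
  ... | w₁ , ab , w₂ = a ∷ w₁ , ab , w₂

  cyclePath : (C : Cycle G m) → ∀ {a b} → EdgeInCycle C a b → Path G a b (suc m)
  cyclePath {m} C (inj₂ ends) =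
    orientPath ends (path (tabulate (vtx C)) (isWalk-tabulate (vtx C) (steps C))
                          (Unique.tabulate⁺ (distinct C)) (length-tabulate (vtx C)))
  cyclePath {m} C (inj₁ (j , ends)) with tabulate-split (vtx C) j
  ... | P , Q , eq with isWalk-split P Q (subst (IsWalk G _ _) eq (isWalk-tabulate (vtx C) (steps C)))
  ...   | w₁ , _ , w₂ = orientPath ends (path (V ++ U) (isWalk-++ w₂ (closing C) w₁)
                                             (unique-++-comm U V (subst Unique eq (Unique.tabulate⁺ (distinct C))))
                                             (≡.trans (↭-length (++-comm V U)) size))
    where
    U V : List (Fin n)
    U = P ∷ʳ vtx C (inject₁ j)
    V = vtx C (suc j) ∷ Q
    size : length (U ++ V) ≡ suc m
    size = ≡.trans (cong length (≡.sym eq)) (length-tabulate (vtx C))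

  lookupAt-first : ∀ {x y xs} → IsWalk G x y xs → (e : length xs ≡ suc m) → lookupAt xs e zero ≡ x
  lookupAt-first [ x ] e = refl
  lookupAt-first (a ∷ w) e = refl

  lookupAt-last : ∀ {x y xs} → IsWalk G x y xs → (e : length xs ≡ suc m) → lookupAt xs e (fromℕ m) ≡ y
  lookupAt-last [ x ] refl = refl
  lookupAt-last {zero} (a ∷ [ _ ]) ()
  lookupAt-last {zero} (a ∷ (_ ∷ _)) ()
  lookupAt-last {suc m} (a ∷ w) e = lookupAt-last w (suc-injective e)

  lookupAt-step : ∀ {x y xs} → IsWalk G x y xs → (e : length xs ≡ suc m) → (j : Fin m) →
                  Adj G (lookupAt xs e (inject₁ j)) (lookupAt xs e (suc j))
  lookupAt-step {suc m} (a ∷ w) e zero = subst (Adj G _) (≡.sym (lookupAt-first w (suc-injective e))) a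
  lookupAt-step {suc m} (a ∷ w) e (suc j) = lookupAt-step w (suc-injective e) j

  pathCycle : ∀ {x y} → Path G x y (suc m) → Adj G x y → Σ (Cycle G m) λ C → EdgeInCycle C x y
  pathCycle {m} (path xs w u s) xy = C , inj₂ (inj₂ (lookupAt-last w s , lookupAt-first w s))
    where
    C : Cycle G m
    C = record { vtx = lookupAt xs s ; distinct = lookupAt-injective xs s u ; steps = lookupAt-step w s
               ; closing = subst₂ (Adj G) (≡.sym (lookupAt-last w s)) (≡.sym (lookupAt-first w s)) (adj-sym G xy) }

  edgePancyclic⇒pathPancyclic : EdgePancyclic G → PathPancyclic G
  edgePancyclic⇒pathPancyclic ep xy (suc m) 3≤k k≤n with ep m 3≤k k≤n _ _ xy
  ... | C , xy∈C = cyclePath C xy∈C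

  pathPancyclic⇒edgePancyclic : PathPancyclic G → EdgePancyclic G
  pathPancyclic⇒edgePancyclic pp m 3≤k k≤n u v uv = pathCycle (pp uv (suc m) 3≤k k≤n) uv

-- Distances

data Walk′ (G : Graph n) : ℕ → Fin n → Fin n → Set where
  []  : ∀ {x} → Walk′ G 0 x x
  _∷_ : ∀ {x y z ℓ} → Adj G x y → Walk′ G ℓ y z → Walk′ G (suc ℓ) x z

WalkWithin : Graph n → ℕ → Fin n → Fin n → Set
WalkWithin G d x y = ∃ λ ℓ → ℓ ≤ d × Walk′ G ℓ x y

Lipschitz : Graph n → (Fin n → ℕ) → Set
Lipschitz G φ = ∀ {x y} → Adj G x y → φ x ≤ suc (φ y)

module _ {G : Graph n} where

  walk′⇒walk : ∀ {x y} → Walk′ G ℓ x y → Walk G ℓ x y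
  walk′⇒walk {x = x} [] = record { wv = λ _ → x ; start = refl ; end = refl ; wstep = λ () }
  walk′⇒walk {x = x} (a ∷ w) with walk′⇒walk w
  ... | W = record { wv = vertexAt ; start = refl ; end = Walk.end W ; wstep = stepAt }
    where
    vertexAt : Fin (suc (suc _)) → Fin n
    vertexAt zero = x
    vertexAt (suc j) = Walk.wv W j
    stepAt : ∀ j → Adj G (vertexAt (inject₁ j)) (vertexAt (suc j))
    stepAt zero = subst (Adj G x) (≡.sym (Walk.start W)) a
    stepAt (suc j) = Walk.wstep W j

  walk⇒walk′ : ∀ {x y} → Walk G ℓ x y → Walk′ G ℓ x y
  walk⇒walk′ {zero} W = subst₂ (Walk′ G 0) (Walk.start W) (Walk.end W) []
  walk⇒walk′ {suc ℓ} W = subst (λ x → Adj G x _) (Walk.start W) (Walk.wstep W zero) ∷ walk⇒walk′ tail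
    where
    tail = record { wv = λ j → Walk.wv W (suc j) ; start = refl ; end = Walk.end W ; wstep = λ j → Walk.wstep W (suc j) }

  walk′-++ : ∀ {x y z ℓ₁ ℓ₂} → Walk′ G ℓ₁ x y → Walk′ G ℓ₂ y z → Walk′ G (ℓ₁ + ℓ₂) x z
  walk′-++ [] v = v
  walk′-++ (a ∷ w) v = a ∷ walk′-++ w v

  walk′-∷ʳ : ∀ {x y z} → Walk′ G ℓ x y → Adj G y z → Walk′ G (suc ℓ) x z
  walk′-∷ʳ [] a = a ∷ []
  walk′-∷ʳ (b ∷ w) a = b ∷ walk′-∷ʳ w a

  walk′-reverse : ∀ {x y} → Walk′ G ℓ x y → Walk′ G ℓ y x
  walk′-reverse [] = []
  walk′-reverse (a ∷ w) = walk′-∷ʳ (walk′-reverse w) (adj-sym G a)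

  walkWithin-reverse : ∀ {d x y} → WalkWithin G d x y → WalkWithin G d y x
  walkWithin-reverse (ℓ , ℓ≤d , w) = ℓ , ℓ≤d , walk′-reverse w

  walk′-map : ∀ {H : Graph m} (e : Embedding G H) {x y} → Walk′ G ℓ x y →
              Walk′ H ℓ (Embedding.vertex e x) (Embedding.vertex e y)
  walk′-map e [] = []
  walk′-map e (a ∷ w) = Embedding.adjacent e a ∷ walk′-map e w

  walk′-lipschitz : ∀ {φ} → Lipschitz G φ → ∀ {x y} → Walk′ G ℓ x y → φ x ≤ ℓ + φ y
  walk′-lipschitz lip [] = ≤-refl
  walk′-lipschitz lip (a ∷ w) = ≤-trans (lip a) (s≤s (walk′-lipschitz lip w))

  isWalk⇒walk′-to-last : ∀ {s e xs z} → IsWalk G s e xs → z ∈ xs → ∃ λ ℓ → Walk′ G ℓ z e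
  isWalk⇒walk′-to-last [ _ ] (here refl) = 0 , []
  isWalk⇒walk′-to-last (a ∷ w) (here refl) = _ , a ∷ proj₂ (isWalk⇒walk′-to-last w (isWalk-first∈ w))
  isWalk⇒walk′-to-last (a ∷ w) (there z∈) = isWalk⇒walk′-to-last w z∈

  isWalk-connects : ∀ {s e xs x y} → IsWalk G s e xs → x ∈ xs → y ∈ xs → ∃ λ ℓ → Walk′ G ℓ x y
  isWalk-connects w x∈ y∈ = _ , walk′-++ (proj₂ (isWalk⇒walk′-to-last w x∈)) (walk′-reverse (proj₂ (isWalk⇒walk′-to-last w y∈)))

Within : Graph n → ℕ → Fin n → Fin n → Set
Within G zero x t = x ≡ t
Within {n} G (suc k) x t = Within G k x t ⊎ Σ (Fin n) λ y → Adj G x y × Within G k y t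

module _ {G : Graph n} where

  within? : ∀ k x t → Dec (Within G k x t)
  within? zero x t = x ≟ t
  within? (suc k) x t = within? k x t ⊎-dec any? λ y → (adj G x y Bool.≟ true) ×-dec within? k y t

  within⇒walkWithin : ∀ {k x t} → Within G k x t → WalkWithin G k x t
  within⇒walkWithin {zero} refl = 0 , z≤n , []
  within⇒walkWithin {suc k} (inj₁ r) with within⇒walkWithin r
  ... | ℓ , ℓ≤k , w = ℓ , ≤-trans ℓ≤k (n≤1+n k) , w
  within⇒walkWithin {suc k} (inj₂ (y , a , r)) with within⇒walkWithin r
  ... | ℓ , ℓ≤k , w = suc ℓ , s≤s ℓ≤k , a ∷ w

  walk′⇒within : ∀ {x t} → Walk′ G ℓ x t → Within G ℓ x t
  walk′⇒within [] = refl
  walk′⇒within (a ∷ w) = inj₂ (_ , a , walk′⇒within w)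

  module Distance (connected : ∀ x t → ∃ λ ℓ → Walk′ G ℓ x t) where

    private
      shortest : ∀ x t → Least λ k → Within G k x t
      shortest x t = least (λ k → within? k x t) _ (walk′⇒within (proj₂ (connected x t)))

    -- Opaque: otherwise conversion checking unfolds the search for a least witness.
    opaque
      dist : Fin n → Fin n → ℕ
      dist x t = proj₁ (shortest x t)

      dist-within : ∀ x t → Within G (dist x t) x t
      dist-within x t = proj₁ (proj₂ (shortest x t))

      dist-minimal : ∀ {k x t} → Within G k x t → dist x t ≤ k
      dist-minimal {k} {x} {t} r = ≮⇒≥ λ k<d → proj₂ (proj₂ (shortest x t)) k<d r

    dist-lipschitz : ∀ t → Lipschitz G λ x → dist x t
    dist-lipschitz t {y = y} a = dist-minimal (inj₂ (y , a , dist-within y t))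

    dist≡0⇒≡ : ∀ {x t} → dist x t ≡ 0 → x ≡ t
    dist≡0⇒≡ {x} {t} e = subst (λ k → Within G k x t) e (dist-within x t)

    dist-self : ∀ t → dist t t ≡ 0
    dist-self t = n≤0⇒n≡0 (dist-minimal {0} refl)

    closer-neighbour : ∀ {x t i} → dist x t ≡ suc i → Σ (Fin n) λ y → Adj G x y × dist y t ≡ i
    closer-neighbour {x} {t} {i} e with subst (λ k → Within G k x t) e (dist-within x t)
    ... | inj₁ r = ⊥-elim (<-irrefl e (s≤s (dist-minimal r)))
    ... | inj₂ (y , a , r) = y , a , ≤-antisym (dist-minimal r) (≤-pred (subst (_≤ suc (dist y t)) e (dist-lipschitz t a)))

    dist-walk : ∀ x t → WalkWithin G (dist x t) x t
    dist-walk x t = within⇒walkWithin (dist-within x t)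

    walk⇒dist≤ : ∀ {x t} → Walk G ℓ x t → dist x t ≤ ℓ
    walk⇒dist≤ W = dist-minimal (walk′⇒within (walk⇒walk′ W))

module _ {G : Graph n} (φ : Fin n → ℕ) (lip : Lipschitz G φ) where

  private
    ivt-up : ∀ {s e ys i y} → IsWalk G s e ys → φ s ≤ i → y ∈ ys → i ≤ φ y → ∃ λ w → w ∈ ys × φ w ≡ i
    ivt-up {s} [ _ ] φs≤i (here refl) i≤φy = s , here refl , ≤-antisym φs≤i i≤φy
    ivt-up {s} (a ∷ w) φs≤i y∈ i≤φy with m≤n⇒m<n∨m≡n φs≤i
    ... | inj₂ φs≡i = s , here refl , φs≡i
    ... | inj₁ φs<i with y∈
    ...   | here refl = ⊥-elim (<⇒≱ φs<i i≤φy)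
    ...   | there y∈′ with ivt-up w (≤-trans (lip (adj-sym G a)) φs<i) y∈′ i≤φy
    ...     | v , v∈ , φv≡i = v , there v∈ , φv≡i

    ivt-down : ∀ {s e ys i y} → IsWalk G s e ys → i ≤ φ s → y ∈ ys → φ y ≤ i → ∃ λ w → w ∈ ys × φ w ≡ i
    ivt-down {s} [ _ ] i≤φs (here refl) φy≤i = s , here refl , ≤-antisym φy≤i i≤φs
    ivt-down {s} (a ∷ w) i≤φs y∈ φy≤i with m≤n⇒m<n∨m≡n i≤φs
    ... | inj₂ i≡φs = s , here refl , ≡.sym i≡φs
    ... | inj₁ i<φs with y∈
    ...   | here refl = ⊥-elim (<⇒≱ i<φs φy≤i)
    ...   | there y∈′ with ivt-down w (≤-pred (≤-trans i<φs (lip a))) y∈′ φy≤i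
    ...     | v , v∈ , φv≡i = v , there v∈ , φv≡i

  intermediate-value : ∀ {s e ys i x y} → IsWalk G s e ys → x ∈ ys → y ∈ ys → φ x ≤ i → i ≤ φ y →
                       ∃ λ w → w ∈ ys × φ w ≡ i
  intermediate-value {s} {i = i} w x∈ y∈ φx≤i i≤φy with ≤-total (φ s) i
  ... | inj₁ φs≤i = ivt-up w φs≤i y∈ i≤φy
  ... | inj₂ i≤φs = ivt-down w i≤φs x∈ φx≤i

-- The 1-Lipschitz height certifies that top and bottom are at distance at least d.
record DiameterWitness (G : Graph n) (d : ℕ) (top : Fin n) : Set where
  field
    near      : ∀ x y → WalkWithin G d x y
    height    : Fin n → ℕ
    lipschitz : Lipschitz G height
    bottom    : Fin n
    tall      : height bottom + d ≤ height top

diameterWitness⇒hasDiameter : ∀ {G : Graph n} {d top} → DiameterWitness G d top → HasDiameter G d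
diameterWitness⇒hasDiameter {d = d} {top} W = within , top , bottom , long
  where
  open DiameterWitness W
  within : ∀ x y → DistAtMost _ x y d
  within x y with near x y
  ... | ℓ , ℓ≤d , w = ℓ , ℓ≤d , walk′⇒walk w
  long : ∀ ℓ → Walk _ ℓ top bottom → d ≤ ℓ
  long ℓ W = +-cancelˡ-≤ (height bottom) d ℓ
    (≤-trans tall (subst (height top ≤_) (+-comm ℓ (height bottom)) (walk′-lipschitz lipschitz (walk⇒walk′ W))))

module _ (G : Graph n) where

  isWalk? : ∀ x y xs → Dec (IsWalk G x y xs)
  isWalk? x y [] = no λ ()
  isWalk? x y (z ∷ []) with x ≟ z | z ≟ y
  ... | yes refl | yes refl = yes [ x ]
  ... | no x≢z | _ = no λ { [ _ ] → x≢z refl }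
  ... | yes _ | no z≢y = no λ { [ _ ] → z≢y refl }
  isWalk? x y (z ∷ w ∷ zs) with x ≟ z | adj G z w Bool.≟ true | isWalk? w y (w ∷ zs)
  ... | yes refl | yes zw | yes rest = yes (zw ∷ rest)
  ... | no x≢z | _ | _ = no λ { (_ ∷ _) → x≢z refl }
  ... | yes refl | no ¬zw | _ = no λ { (zw ∷ [ _ ]) → ¬zw zw ; (zw ∷ (_ ∷ _)) → ¬zw zw }
  ... | yes refl | yes _ | no ¬rest = no λ { (_ ∷ rest@([ _ ])) → ¬rest rest ; (_ ∷ rest@(_ ∷ _)) → ¬rest rest }

  IsPath : Fin n → Fin n → ℕ → List (Fin n) → Set
  IsPath x y k xs = IsWalk G x y xs × Unique xs × length xs ≡ k

  isPath? : ∀ x y k xs → Dec (IsPath x y k xs)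
  isPath? x y k xs = isWalk? x y xs ×-dec unique? xs ×-dec (length xs ≟ℕ k)
    where open import Data.List.Relation.Unary.Unique.DecPropositional (_≟_ {n}) using (unique?)

  isPath⇒path : ∀ {x y k xs} → IsPath x y k xs → Path G x y k
  isPath⇒path (w , u , s) = path _ w u s

  concretePath : ∀ {x y k} xs → {True (isPath? x y k xs)} → Path G x y k
  concretePath xs {ok} = isPath⇒path (toWitness ok)

-- The successors only propose candidate paths; each candidate is checked by isPath?.
module Search (G : Graph n) (successors : Fin n → List (Fin n)) where

  simplePaths : ℕ → Fin n → List (List (Fin n))
  simplePaths zero x = []
  simplePaths (suc zero) x = (x ∷ []) ∷ []
  simplePaths (suc (suc k)) x =
    concatMap (λ y → map (x ∷_) (filter (λ p → ¬? (Any.any? (x ≟_) p)) (simplePaths (suc k) y))) (successors x)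

  PathFound : Fin n → Fin n → ℕ → (List (Fin n) → Set) → Set
  PathFound x y k Q = Any (λ xs → IsPath G x y k xs × Q xs) (simplePaths k x)

  pathFound? : ∀ x y k {Q} → (∀ xs → Dec (Q xs)) → Dec (PathFound x y k Q)
  pathFound? x y k Q? = Any.any? (λ xs → isPath? G x y k xs ×-dec Q? xs) (simplePaths k x)

  found⇒path : ∀ {x y k Q} → PathFound x y k Q → Σ (Path G x y k) (Q ∘ Path.vertices)
  found⇒path found with Any.satisfied found
  ... | _ , isPath , q = isPath⇒path G isPath , q

  pancyclic? : Dec (∀ x y → Adj G x y → ∀ {k} → k < suc n → 3 ≤ k → PathFound x y k λ _ → ⊤)
  pancyclic? = all? λ x → all? λ y → (adj G x y Bool.≟ true) →-dec
                 allUpTo? (λ k → 3 ≤? k →-dec pathFound? x y k λ _ → yes tt) (suc n)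

  searched-pathPancyclic : True pancyclic? → PathPancyclic G
  searched-pathPancyclic ok {x} {y} xy k 3≤k k≤n = proj₁ (found⇒path (toWitness ok x y xy (s≤s k≤n) 3≤k))

  pathsVia? : ∀ k v → Dec (∀ x y → Adj G x y → PathFound x y k (v ∈_))
  pathsVia? k v = all? λ x → all? λ y → (adj G x y Bool.≟ true) →-dec pathFound? x y k (Any.any? (v ≟_))

  searched-pathVia : ∀ {k v} → True (pathsVia? k v) → ∀ {x y} → Adj G x y → PathVia G x y k v
  searched-pathVia {k} {v} ok {x} {y} xy = found⇒path (toWitness {a? = pathsVia? k v} ok x y xy)

  allWithin? : ∀ d → Dec (∀ x y → Within G d x y)
  allWithin? d = all? λ x → all? λ y → within? d x y

  lipschitz? : (h : Fin n → ℕ) → Dec (∀ x y → Adj G x y → h x ≤ suc (h y))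
  lipschitz? h = all? λ x → all? λ y → (adj G x y Bool.≟ true) →-dec (h x ≤? suc (h y))

  checked-diameter : ∀ d (h : Fin n → ℕ) top bottom → True (allWithin? d) → True (lipschitz? h) → True (h bottom + d ≤? h top) →
                     DiameterWitness G d top
  checked-diameter d h top bottom near lip tall = record
    { near = λ x y → within⇒walkWithin (toWitness {a? = allWithin? d} near x y) ; height = h
    ; lipschitz = λ {x} {y} → toWitness {a? = lipschitz? h} lip x y ; bottom = bottom
    ; tall = toWitness {a? = h bottom + d ≤? h top} tall }

neighbourAdj : (Fin n → List (Fin n)) → Fin n → Fin n → Bool
neighbourAdj N x y = does (Any.any? (y ≟_) (N x))

fromNeighbours : (N : Fin n → List (Fin n)) →
                 {True (all? λ x → all? λ y → neighbourAdj N x y Bool.≟ neighbourAdj N y x)} →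
                 {True (all? λ x → neighbourAdj N x x Bool.≟ false)} → Graph n
fromNeighbours N {sym-ok} {irref-ok} = record { adj = neighbourAdj N ; sym = toWitness sym-ok ; irref = toWitness irref-ok }

-- The upper bound

module UpperBound {G : Graph n} (pancyclic : PathPancyclic G) (3≤n : 3 ≤ n) {u₀ v₀ : Fin n} (u₀v₀ : Adj G u₀ v₀) where

  hamiltonian : ∀ {a b} → Adj G a b → Path G a b n
  hamiltonian ab = pancyclic ab n 3≤n ≤-refl

  triangle : ∀ {x y} → Adj G x y → ∃ λ t → Adj G x t × Adj G t y
  triangle xy with pancyclic xy 3 ≤-refl 3≤n
  ... | path _ (xt ∷ (ty ∷ [ _ ])) _ _ = _ , xt , ty
  ... | path _ [ _ ] _ ()
  ... | path _ (_ ∷ [ _ ]) _ ()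
  ... | path _ (_ ∷ _ ∷ _ ∷ [ _ ]) _ ()
  ... | path _ (_ ∷ _ ∷ _ ∷ _ ∷ _) _ ()

  connected : ∀ x t → ∃ λ ℓ → Walk′ G ℓ x t
  connected x t = isWalk-connects (Path.walk H) (hamiltonianPath-complete H x) (hamiltonianPath-complete H t)
    where
    H : Path G u₀ v₀ n
    H = hamiltonian u₀v₀

  open Distance connected

  private
    pairs : List (Fin n × Fin n)
    pairs = cartesianProduct (allFin n) (allFin n)

  opaque
    diametral : Fin n × Fin n
    diametral = argmax (uncurry dist) (u₀ , u₀) pairs

    dist≤diametral : ∀ x y → dist x y ≤ uncurry dist diametral
    dist≤diametral x y = All.lookup (f[xs]≤f[argmax] (u₀ , u₀) pairs) (∈-cartesianProduct⁺ (∈-allFin x) (∈-allFin y))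

  p q : Fin n
  p = proj₁ diametral
  q = proj₂ diametral

  D : ℕ
  D = dist p q

  dist≤D : ∀ x y → dist x y ≤ D
  dist≤D = dist≤diametral

  hasDiameter : HasDiameter G D
  hasDiameter = within-D , p , q , λ ℓ → walk⇒dist≤
    where
    within-D : ∀ x y → DistAtMost G x y D
    within-D x y with dist-walk x y
    ... | ℓ , ℓ≤d , w = ℓ , ≤-trans ℓ≤d (dist≤D x y) , walk′⇒walk w

  layer : Fin n → ℕ
  layer x = dist x q

  layer-q : layer q ≡ 0
  layer-q = dist-self q

  layer-inhabited : ∀ {x k} → layer x ≡ k → ∀ i → i ≤ k → ∃ λ y → layer y ≡ i
  layer-inhabited {x} {zero} e zero _ = x , e
  layer-inhabited {x} {suc k} e i i≤k with m≤n⇒m<n∨m≡n i≤k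
  ... | inj₂ refl = x , e
  ... | inj₁ i<k = layer-inhabited (proj₂ (proj₂ (closer-neighbour e))) i (≤-pred i<k)

  positive-layer-neighbour : ∀ {x i} → layer x ≡ i → 1 ≤ i → ∃ λ y → Adj G x y
  positive-layer-neighbour e (s≤s _) = _ , proj₁ (proj₂ (closer-neighbour e))

  layerSize : ℕ → ℕ
  layerSize i = count λ x → does (layer x ≟ℕ i)

  layerSize≥ : ∀ {i xs} → Unique xs → All (λ x → layer x ≡ i) xs → length xs ≤ layerSize i
  layerSize≥ {i} u all = unique⇒length≤count _ u (All.map (λ {x} → dec-true (layer x ≟ℕ i)) all)

  layerSize≥1 : ∀ {x i} → layer x ≡ i → 1 ≤ layerSize i
  layerSize≥1 e = layerSize≥ (All.[] ∷ []) (e ∷ [])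

  layerSize≥2 : ∀ {x y i} → layer x ≡ i → layer y ≡ i → x ≢ y → 2 ≤ layerSize i
  layerSize≥2 ex ey x≢y = layerSize≥ ((x≢y ∷ []) ∷ [] ∷ []) (ex ∷ ey ∷ [])

  layerSize≥3 : ∀ {x y z i} → layer x ≡ i → layer y ≡ i → layer z ≡ i → x ≢ y → x ≢ z → y ≢ z → 3 ≤ layerSize i
  layerSize≥3 ex ey ez x≢y x≢z y≢z = layerSize≥ ((x≢y ∷ x≢z ∷ []) ∷ (y≢z ∷ []) ∷ [] ∷ []) (ex ∷ ey ∷ ez ∷ [])

  InnerEdge : ℕ → Set
  InnerEdge i = ∃ λ a → ∃ λ b → Adj G a b × layer a ≡ i × layer b ≡ i

  innerEdge⇒layerSize≥2 : ∀ {i} → InnerEdge i → 2 ≤ layerSize i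
  innerEdge⇒layerSize≥2 (a , b , ab , ea , eb) = layerSize≥2 ea eb (adj⇒≢ G ab)

  no-innerEdge₀ : ¬ InnerEdge 0
  no-innerEdge₀ (a , b , ab , ea , eb) rewrite dist≡0⇒≡ ea | dist≡0⇒≡ eb = adj-irrefl G ab

  descending-edge : ∀ {x y i} → Adj G x y → layer x ≡ suc i → layer y ≡ i → InnerEdge i ⊎ InnerEdge (suc i)
  descending-edge {x} {y} {i} xy ex ey with triangle xy
  ... | t , xt , ty with m≤n⇒m<n∨m≡n upper
    where
    upper : layer t ≤ suc i
    upper = subst (λ k → layer t ≤ suc k) ey (dist-lipschitz q ty)
  ... | inj₁ t<1+i = inj₁ (t , y , ty , ≤-antisym (≤-pred t<1+i) lower , ey)
    where
    lower : i ≤ layer t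
    lower = ≤-pred (subst (_≤ suc (layer t)) ex (dist-lipschitz q xt))
  ... | inj₂ t≡1+i = inj₂ (x , t , xt , ex , t≡1+i)

  module Middle {i} (1≤i : 1 ≤ i) (i<D : i < D) where

    p∉layer : ∀ {z} → layer z ≡ i → z ≢ p
    p∉layer e refl = <-irrefl (≡.sym e) i<D

    q∉layer : ∀ {z} → layer z ≡ i → z ≢ q
    q∉layer e refl = <-irrefl (≡.trans (≡.sym layer-q) e) 1≤i

    walk-meets-layer : ∀ {s e ys} → IsWalk G s e ys → q ∈ ys → p ∈ ys → ∃ λ w → w ∈ ys × layer w ≡ i
    walk-meets-layer w q∈ p∈ =
      intermediate-value layer (dist-lipschitz q) w q∈ p∈ (subst (_≤ i) (≡.sym layer-q) z≤n) (<⇒≤ i<D)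

    another-vertex : ∀ {a b} → Adj G a b → layer a ≡ i → ∃ λ w → layer w ≡ i × w ≢ a
    another-vertex ab ea with hamiltonian ab
    ... | path _ [ _ ] _ _ = ⊥-elim (adj-irrefl G ab)
    ... | P@(path _ (_ ∷ rest) (a∉ ∷ _) _) with walk-meets-layer rest (inner q (q∉layer ea)) (inner p (p∉layer ea))
      where
      inner : ∀ z → _ ≢ z → z ∈ _
      inner z a≢z = ∈-∷⁻ (hamiltonianPath-complete P z) (a≢z ∘ ≡.sym)
    ... | w , w∈ , ew = w , ew , λ { refl → All¬⇒¬Any a∉ w∈ }

    third-vertex : ∀ {a b} → Adj G a b → layer a ≡ i → layer b ≡ i → ∃ λ w → layer w ≡ i × w ≢ a × w ≢ b
    third-vertex ab ea eb with hamiltonian ab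
    ... | path _ [ _ ] _ _ = ⊥-elim (adj-irrefl G ab)
    ... | P@(path _ (_ ∷ rest) (a∉ ∷ u) _) with isWalk-unsnoc rest
    ...   | inj₁ refl = ⊥-elim (ends-not-p (hamiltonianPath-complete P p))
      where
      ends-not-p : p ∉ _ ∷ _ ∷ []
      ends-not-p (here refl) = p∉layer ea refl
      ends-not-p (there (here refl)) = p∉layer eb refl
    ...   | inj₂ (mid , c , refl , w′) with walk-meets-layer w′ (inner q (q∉layer ea) (q∉layer eb)) (inner p (p∉layer ea) (p∉layer eb))
      where
      inner : ∀ z → _ ≢ z → _ ≢ z → z ∈ mid
      inner z a≢z b≢z = ∈-∷ʳ⁻ (∈-∷⁻ (hamiltonianPath-complete P z) (a≢z ∘ ≡.sym)) (b≢z ∘ ≡.sym)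
    ...     | w , w∈ , ew = w , ew , (λ { refl → All¬⇒¬Any a∉ (∈-++⁺ˡ w∈) }) , λ { refl → unique-∷ʳ⇒∉ u w∈ }

    layerSize≥2-middle : 2 ≤ layerSize i
    layerSize≥2-middle with layer-inhabited {p} refl i (<⇒≤ i<D)
    ... | a , ea with another-vertex (proj₂ (positive-layer-neighbour ea 1≤i)) ea
    ... | w , ew , w≢a = layerSize≥2 ea ew (w≢a ∘ ≡.sym)

    innerEdge⇒layerSize≥3 : InnerEdge i → 3 ≤ layerSize i
    innerEdge⇒layerSize≥3 (a , b , ab , ea , eb) with third-vertex ab ea eb
    ... | w , ew , w≢a , w≢b = layerSize≥3 ea eb ew (adj⇒≢ G ab) (w≢a ∘ ≡.sym) (w≢b ∘ ≡.sym)

  first-pair : 2 ≤ D → 4 ≤ layerSize 0 + layerSize 1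
  first-pair 2≤D with layer-inhabited {p} refl 1 (≤-trans (n≤1+n 1) 2≤D)
  ... | a , ea with closer-neighbour ea
  ... | y , ay , ey with descending-edge ay ea ey
  ... | inj₁ inner₀ = ⊥-elim (no-innerEdge₀ inner₀)
  ... | inj₂ inner₁ = +-mono-≤ (layerSize≥1 layer-q) (Middle.innerEdge⇒layerSize≥3 ≤-refl 2≤D inner₁)

  middle-pair : ∀ i → 1 ≤ i → 2 + i ≤ D → 5 ≤ layerSize i + layerSize (suc i)
  middle-pair i 1≤i 2+i≤D with layer-inhabited {p} refl (suc i) (≤-trans (n≤1+n _) 2+i≤D)
  ... | a , ea with closer-neighbour ea
  ... | y , ay , ey with descending-edge ay ea ey
  ... | inj₁ lower = +-mono-≤ (Middle.innerEdge⇒layerSize≥3 1≤i (≤-trans (n≤1+n _) 2+i≤D) lower)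
                              (Middle.layerSize≥2-middle (s≤s z≤n) 2+i≤D)
  ... | inj₂ upper = +-mono-≤ (Middle.layerSize≥2-middle 1≤i (≤-trans (n≤1+n _) 2+i≤D))
                              (Middle.innerEdge⇒layerSize≥3 (s≤s z≤n) 2+i≤D upper)

  last-pair : ∀ {D′} → D ≡ suc D′ → 1 ≤ D′ → 4 ≤ layerSize D′ + layerSize D
  last-pair e 1≤D′ with closer-neighbour e
  ... | y , py , ey with descending-edge py e ey
  ... | inj₁ inner = +-mono-≤ (Middle.innerEdge⇒layerSize≥3 1≤D′ (≤-reflexive (≡.sym e)) inner) (layerSize≥1 {p} refl)
  ... | inj₂ top = +-mono-≤ (Middle.layerSize≥2-middle 1≤D′ (≤-reflexive (≡.sym e)))
                            (subst (λ k → 2 ≤ layerSize k) (≡.sym e) (innerEdge⇒layerSize≥2 top))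

  5D≤2n : 5 * D ≤ 2 * n
  5D≤2n = bound D refl
    where
    bound : ∀ d → D ≡ d → 5 * D ≤ 2 * n
    bound zero e rewrite e = z≤n
    bound (suc zero) e rewrite e = ≤-trans (n≤1+n 5) (*-monoʳ-≤ 2 3≤n)
    bound (suc (suc d)) e =
      ≤-trans (five-halves-bound layerSize D (layerSize≥1 layer-q) (first-pair D≥2) middle-pair (suc d) e (s≤s z≤n)
                                 (last-pair e (s≤s z≤n)) (layerSize≥1 {p} refl))
              (*-monoʳ-≤ 2 (sumBelow-fibres≤ (suc D) layer))
      where
      D≥2 : 2 ≤ D
      D≥2 = subst (2 ≤_) (≡.sym e) (s≤s (s≤s z≤n))

  diameter≤2n/5 : D ≤ (2 * n) / 5
  diameter≤2n/5 = *≤⇒≤/ D 5 (2 * n) (subst (_≤ 2 * n) (*-comm 5 D) 5D≤2n)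

-- Twins

module Twin (G : Graph n) (x₀ : Fin n) where

  twinAdj : Fin (suc n) → Fin (suc n) → Bool
  twinAdj zero    zero    = false
  twinAdj zero    (suc j) = does (j ≟ x₀) ∨ adj G x₀ j
  twinAdj (suc i) zero    = does (i ≟ x₀) ∨ adj G x₀ i
  twinAdj (suc i) (suc j) = adj G i j

  twin : Graph (suc n)
  twin = record { adj = twinAdj ; sym = symmetric ; irref = irreflexive }
    where
    symmetric : ∀ u v → twinAdj u v ≡ twinAdj v u
    symmetric zero    zero    = refl
    symmetric zero    (suc j) = refl
    symmetric (suc i) zero    = refl
    symmetric (suc i) (suc j) = Graph.sym G i j
    irreflexive : ∀ v → twinAdj v v ≡ false
    irreflexive zero    = refl
    irreflexive (suc i) = irref G i

  old : Embedding G twin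
  old = record { vertex = suc ; injective = Fin.suc-injective ; adjacent = λ a → a }

  twin-x₀ : Adj twin zero (suc x₀)
  twin-x₀ rewrite dec-true (x₀ ≟ x₀) refl = refl

  x₀-twin : Adj twin (suc x₀) zero
  x₀-twin = adj-sym twin {zero} {suc x₀} twin-x₀

  twin-neighbour : ∀ {j} → Adj G x₀ j → Adj twin zero (suc j)
  twin-neighbour {j} a rewrite a = ∨-zeroʳ (does (j ≟ x₀))

  twin-adj⁻ : ∀ {j} → Adj twin zero (suc j) → j ≡ x₀ ⊎ Adj G x₀ j
  twin-adj⁻ {j} a with j ≟ x₀
  ... | yes j≡x₀ = inj₁ j≡x₀
  ... | no _ = inj₂ a

  module _ (pancyclic : PathPancyclic G) {z₀} (x₀z₀ : Adj G x₀ z₀) (3≤n : 3 ≤ n) where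

    hamiltonian-old : ∀ {i j} → Adj G i j → Path twin (suc i) (suc j) (suc n)
    hamiltonian-old ij =
      proj₁ (insertAt old (adj⇒≢ G ij) (P , hamiltonianPath-complete P x₀) x₀-twin (path (zero ∷ []) [ zero ] (All.[] ∷ []) refl)
                      twin-neighbour λ { (here refl) _ () })
      where
      P : Path G _ _ n
      P = pancyclic ij n 3≤n ≤-refl

    from-twin : ∀ {j} → Adj twin zero (suc j) → ∀ k → 2 ≤ k → k ≤ n → Path twin zero (suc j) (suc k)
    from-twin a k 2≤k k≤n with twin-adj⁻ a
    ... | inj₁ refl = prependPath (twin-neighbour x₀z₀) (mapPath old Q) (zero∉map-suc (Path.vertices Q))
      where
      Q : Path G z₀ x₀ k
      Q = pathOrEdge pancyclic (adj-sym G x₀z₀) k 2≤k k≤n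
    ... | inj₂ x₀j = prependPath twin-x₀ (mapPath old Q) (zero∉map-suc (Path.vertices Q))
      where
      Q : Path G x₀ _ k
      Q = pathOrEdge pancyclic x₀j k 2≤k k≤n

    twin-pathPancyclic : PathPancyclic twin
    twin-pathPancyclic {zero} {zero} a = ⊥-elim (adj-irrefl twin {zero} a)
    twin-pathPancyclic {zero} {suc j} a (suc k) (s≤s 2≤k) (s≤s k≤n) = from-twin a k 2≤k k≤n
    twin-pathPancyclic {suc i} {zero} a (suc k) (s≤s 2≤k) (s≤s k≤n) = reversePath (from-twin (adj-sym twin {suc i} {zero} a) k 2≤k k≤n)
    twin-pathPancyclic {suc i} {suc j} a k 3≤k k≤1+n with m≤n⇒m<n∨m≡n k≤1+n
    ... | inj₁ k≤n = mapPath old (pancyclic a k 3≤k (≤-pred k≤n))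
    ... | inj₂ refl = hamiltonian-old a

  module _ {d top} (W : DiameterWitness G d top) (1≤d : 1 ≤ d) where
    open DiameterWitness W

    from-twin-near : ∀ y → WalkWithin twin d zero (suc y)
    from-twin-near y with y ≟ x₀
    ... | yes refl = 1 , 1≤d , x₀-twin ∷ []
    ... | no y≢x₀ with near x₀ y
    ...   | zero , _ , [] = ⊥-elim (y≢x₀ refl)
    ...   | suc ℓ , ℓ≤d , (a ∷ w) = suc ℓ , ℓ≤d , twin-neighbour a ∷ walk′-map old w

    twin-near : ∀ x y → WalkWithin twin d x y
    twin-near zero zero = 0 , z≤n , []
    twin-near zero (suc y) = from-twin-near y
    twin-near (suc x) zero = walkWithin-reverse (from-twin-near x)
    twin-near (suc x) (suc y) with near x y
    ... | ℓ , ℓ≤d , w = ℓ , ℓ≤d , walk′-map old w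

    twin-height : Fin (suc n) → ℕ
    twin-height zero = height x₀
    twin-height (suc i) = height i

    twin-lipschitz : Lipschitz twin twin-height
    twin-lipschitz {zero} {zero} a = ⊥-elim (adj-irrefl twin {zero} a)
    twin-lipschitz {zero} {suc j} a with twin-adj⁻ a
    ... | inj₁ refl = n≤1+n _
    ... | inj₂ x₀j = lipschitz x₀j
    twin-lipschitz {suc i} {zero} a with twin-adj⁻ (adj-sym twin {suc i} {zero} a)
    ... | inj₁ refl = n≤1+n _
    ... | inj₂ x₀i = lipschitz (adj-sym G x₀i)
    twin-lipschitz {suc i} {suc j} a = lipschitz a

    twin-diameter : DiameterWitness twin d (suc top)
    twin-diameter = record { near = twin-near ; height = twin-height ; lipschitz = λ {x} {y} → twin-lipschitz {x} {y}
                           ; bottom = suc bottom ; tall = tall }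

record Realisation (N d : ℕ) : Set where
  field
    graph     : Graph N
    pancyclic : PathPancyclic graph
    hub spoke : Fin N
    hub-spoke : Adj graph hub spoke
    top       : Fin N
    diameter  : DiameterWitness graph d top

addTwin : ∀ {N d} → 3 ≤ N → 1 ≤ d → Realisation N d → Realisation (suc N) d
addTwin 3≤N 1≤d R = record
  { graph = twin ; pancyclic = twin-pathPancyclic pancyclic hub-spoke 3≤N
  ; hub = suc hub ; spoke = zero ; hub-spoke = x₀-twin
  ; top = suc top ; diameter = twin-diameter diameter 1≤d }
  where
  open Realisation R
  open Twin graph hub

grow : ∀ {N₀ N d} → 3 ≤ N₀ → 1 ≤ d → Realisation N₀ d → N₀ ≤ N → Realisation N d
grow {N₀} {suc N} 3≤N₀ 1≤d R N₀≤N with m≤n⇒m<n∨m≡n N₀≤N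
... | inj₁ (s≤s N₀≤N′) = addTwin (≤-trans 3≤N₀ N₀≤N′) 1≤d (grow 3≤N₀ 1≤d R N₀≤N′)
... | inj₂ refl = R
grow {zero} {zero} () _ _ _

realisation⇒extremal : ∀ {N d} (R : Realisation N d) → let G = Realisation.graph R in
                       EdgePancyclic G × HasEdge G × HasDiameter G d
realisation⇒extremal R = pathPancyclic⇒edgePancyclic pancyclic , (hub , spoke , hub-spoke) , diameterWitness⇒hasDiameter diameter
  where open Realisation R

-- The gadget

data NewVertex : Set where
  apex   : NewVertex
  tri    : Fin 3 → NewVertex
  mirror : NewVertex

pattern new v = inj₁ v
pattern orig i = inj₂ i

module Gadget {n} (G : Graph (suc n)) where

  M : ℕ
  M = suc n

  Vertex : Set
  Vertex = NewVertex ⊎ Fin M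

  encode : Vertex → Fin (5 + M)
  encode (new apex)             = zero
  encode (new (tri zero))       = suc zero
  encode (new (tri (suc zero))) = suc (suc zero)
  encode (new (tri (suc (suc zero)))) = suc (suc (suc zero))
  encode (new mirror)           = suc (suc (suc (suc zero)))
  encode (orig i)               = suc (suc (suc (suc (suc i))))

  decode : Fin (5 + M) → Vertex
  decode zero = new apex
  decode (suc zero) = new (tri zero)
  decode (suc (suc zero)) = new (tri (suc zero))
  decode (suc (suc (suc zero))) = new (tri (suc (suc zero)))
  decode (suc (suc (suc (suc zero)))) = new mirror
  decode (suc (suc (suc (suc (suc i))))) = orig i

  encode-decode : ∀ X → encode (decode X) ≡ X
  encode-decode zero = refl
  encode-decode (suc zero) = refl
  encode-decode (suc (suc zero)) = refl
  encode-decode (suc (suc (suc zero))) = refl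
  encode-decode (suc (suc (suc (suc zero)))) = refl
  encode-decode (suc (suc (suc (suc (suc i))))) = refl

  decode-encode : ∀ v → decode (encode v) ≡ v
  decode-encode (new apex) = refl
  decode-encode (new (tri zero)) = refl
  decode-encode (new (tri (suc zero))) = refl
  decode-encode (new (tri (suc (suc zero)))) = refl
  decode-encode (new mirror) = refl
  decode-encode (orig i) = refl

  encode-injective : Injective _≡_ _≡_ encode
  encode-injective {u} {v} eq = ≡.trans (≡.sym (decode-encode u)) (≡.trans (cong decode eq) (decode-encode v))

  link : Vertex → Vertex → Bool
  link (new apex)    (new (tri _))  = true
  link (new (tri _)) (new apex)     = true
  link (new (tri x)) (new (tri y))  = not (does (x ≟ y))
  link (new (tri _)) (new mirror)   = true
  link (new mirror)  (new (tri _))  = true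
  link (new (tri _)) (orig i)       = does (i ≟ zero)
  link (orig i)      (new (tri _))  = does (i ≟ zero)
  link (new mirror)  (orig j)       = adj G zero j
  link (orig i)      (new mirror)   = adj G zero i
  link (orig i)      (orig j)       = adj G i j
  link _             _              = false

  link-sym : ∀ u v → link u v ≡ link v u
  link-sym (new apex)    (new apex)          = refl
  link-sym (new apex)    (new (tri _))       = refl
  link-sym (new apex)    (new mirror)        = refl
  link-sym (new apex)    (orig _)            = refl
  link-sym (new (tri _)) (new apex)          = refl
  link-sym (new (tri x)) (new (tri y))       = cong not (does-≟-comm x y)
  link-sym (new (tri _)) (new mirror)        = refl
  link-sym (new (tri _)) (orig _)            = refl
  link-sym (new mirror)  (new apex)          = refl
  link-sym (new mirror)  (new (tri _))       = refl
  link-sym (new mirror)  (new mirror)        = refl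
  link-sym (new mirror)  (orig _)            = refl
  link-sym (orig _)      (new apex)          = refl
  link-sym (orig _)      (new (tri _))       = refl
  link-sym (orig _)      (new mirror)        = refl
  link-sym (orig i)      (orig j)            = Graph.sym G i j

  link-irrefl : ∀ v → link v v ≡ false
  link-irrefl (new apex) = refl
  link-irrefl (new (tri x)) = cong not (dec-true (x ≟ x) refl)
  link-irrefl (new mirror) = refl
  link-irrefl (orig i) = irref G i

  gadget : Graph (5 + M)
  gadget = record { adj = λ X Y → link (decode X) (decode Y)
                  ; sym = λ X Y → link-sym (decode X) (decode Y)
                  ; irref = λ X → link-irrefl (decode X) }

  old : Embedding G gadget
  old = record { vertex = λ i → encode (orig i) ; injective = λ { refl → refl } ; adjacent = λ a → a }

  fresh-new : ∀ (vs : List NewVertex) → Fresh old (map (encode ∘ new) vs)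
  fresh-new vs v∈ x v≡ with ∈-map⁻ (encode ∘ new) v∈
  ... | w , _ , refl with encode-injective {new w} {orig x} v≡
  ... | ()

  record Symmetry : Set where
    field
      τ τ⁻¹      : Vertex → Vertex
      inverseˡ   : ∀ v → τ⁻¹ (τ v) ≡ v
      preserves  : ∀ u v → link (τ u) (τ v) ≡ link u v
      fixes-apex : τ (new apex) ≡ new apex

  symmetry⇒embedding : Symmetry → Embedding gadget gadget
  symmetry⇒embedding S = record { vertex = h ; injective = h-injective ; adjacent = h-adjacent }
    where
    open Symmetry S
    h : Fin (5 + M) → Fin (5 + M)
    h X = encode (τ (decode X))
    h-injective : Injective _≡_ _≡_ h
    h-injective {X} {Y} eq = begin
      X                           ≡⟨ ≡.sym (encode-decode X) ⟩
      encode (decode X)           ≡⟨ cong encode (≡.sym (inverseˡ (decode X))) ⟩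
      encode (τ⁻¹ (τ (decode X))) ≡⟨ cong (encode ∘ τ⁻¹) (encode-injective eq) ⟩
      encode (τ⁻¹ (τ (decode Y))) ≡⟨ cong encode (inverseˡ (decode Y)) ⟩
      encode (decode Y)           ≡⟨ encode-decode Y ⟩
      Y                           ∎
      where open ≡.≡-Reasoning
    h-adjacent : ∀ {X Y} → Adj gadget X Y → Adj gadget (h X) (h Y)
    h-adjacent {X} {Y} a rewrite decode-encode (τ (decode X)) | decode-encode (τ (decode Y)) | preserves (decode X) (decode Y) = a

  swapMirror : Symmetry
  swapMirror = record { τ = σ ; τ⁻¹ = σ ; inverseˡ = σ-involutive ; preserves = σ-preserves ; fixes-apex = refl }
    where
    σ : Vertex → Vertex
    σ (new mirror)     = orig zero
    σ (orig zero)      = new mirror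
    σ (new apex)       = new apex
    σ (new (tri x))    = new (tri x)
    σ (orig (suc i))   = orig (suc i)
    σ-involutive : ∀ v → σ (σ v) ≡ v
    σ-involutive (new mirror)   = refl
    σ-involutive (orig zero)    = refl
    σ-involutive (new apex)     = refl
    σ-involutive (new (tri x))  = refl
    σ-involutive (orig (suc i)) = refl
    σ-preserves : ∀ u v → link (σ u) (σ v) ≡ link u v
    σ-preserves (new apex)     (new apex)     = refl
    σ-preserves (new apex)     (new (tri _))  = refl
    σ-preserves (new apex)     (new mirror)   = refl
    σ-preserves (new apex)     (orig zero)    = refl
    σ-preserves (new apex)     (orig (suc _)) = refl
    σ-preserves (new (tri _))  (new apex)     = refl
    σ-preserves (new (tri _))  (new (tri _))  = refl
    σ-preserves (new (tri _))  (new mirror)   = refl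
    σ-preserves (new (tri _))  (orig zero)    = refl
    σ-preserves (new (tri _))  (orig (suc _)) = refl
    σ-preserves (new mirror)   (new apex)     = refl
    σ-preserves (new mirror)   (new (tri _))  = refl
    σ-preserves (new mirror)   (new mirror)   = irref G zero
    σ-preserves (new mirror)   (orig zero)    = refl
    σ-preserves (new mirror)   (orig (suc _)) = refl
    σ-preserves (orig zero)    (new apex)     = refl
    σ-preserves (orig zero)    (new (tri _))  = refl
    σ-preserves (orig zero)    (new mirror)   = refl
    σ-preserves (orig zero)    (orig zero)    = ≡.sym (irref G zero)
    σ-preserves (orig zero)    (orig (suc _)) = refl
    σ-preserves (orig (suc _)) (new apex)     = refl
    σ-preserves (orig (suc _)) (new (tri _))  = refl
    σ-preserves (orig (suc i)) (new mirror)   = Graph.sym G (suc i) zero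
    σ-preserves (orig (suc i)) (orig zero)    = Graph.sym G zero (suc i)
    σ-preserves (orig (suc _)) (orig (suc _)) = refl

  relabel : Fin 3 → Fin 3 → Symmetry
  relabel i j = record { τ = on-tri (transpose i j) ; τ⁻¹ = on-tri (transpose j i) ; inverseˡ = inverse
                       ; preserves = preserves ; fixes-apex = refl }
    where
    on-tri : (Fin 3 → Fin 3) → Vertex → Vertex
    on-tri π (new (tri x)) = new (tri (π x))
    on-tri π v             = v
    inverse : ∀ v → on-tri (transpose j i) (on-tri (transpose i j) v) ≡ v
    inverse (new apex)    = refl
    inverse (new (tri x)) = cong (λ y → new (tri y)) (transpose-inverse j i)
    inverse (new mirror)  = refl
    inverse (orig _)      = refl
    π-injective : Injective _≡_ _≡_ (transpose i j)
    π-injective {x} {y} eq = ≡.trans (≡.sym (transpose-inverse j i)) (≡.trans (cong (transpose j i) eq) (transpose-inverse j i))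
    preserves : ∀ u v → link (on-tri (transpose i j) u) (on-tri (transpose i j) v) ≡ link u v
    preserves (new (tri x)) (new (tri y))  = cong not (does-≟-injective π-injective x y)
    preserves (new apex)    (new apex)     = refl
    preserves (new apex)    (new (tri _))  = refl
    preserves (new apex)    (new mirror)   = refl
    preserves (new apex)    (orig _)       = refl
    preserves (new (tri _)) (new apex)     = refl
    preserves (new (tri _)) (new mirror)   = refl
    preserves (new (tri _)) (orig _)       = refl
    preserves (new mirror)  (new apex)     = refl
    preserves (new mirror)  (new (tri _))  = refl
    preserves (new mirror)  (new mirror)   = refl
    preserves (new mirror)  (orig _)       = refl
    preserves (orig _)      (new apex)     = refl
    preserves (orig _)      (new (tri _))  = refl
    preserves (orig _)      (new mirror)   = refl
    preserves (orig _)      (orig _)       = refl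

  V B o₀ : Fin (5 + M)
  V = encode (new apex)
  B = encode (new mirror)
  o₀ = encode (orig zero)

  C : Fin 3 → Fin (5 + M)
  C x = encode (new (tri x))

  t₀ t₁ t₂ : NewVertex
  t₀ = tri zero
  t₁ = tri (suc zero)
  t₂ = tri (suc (suc zero))

  C₀ C₁ C₂ : Fin (5 + M)
  C₀ = encode (new t₀)
  C₁ = encode (new t₁)
  C₂ = encode (new t₂)

  Good : Fin (5 + M) → Fin (5 + M) → Set
  Good X Y = (∀ k → 3 ≤ k → k ≤ 5 + M → Path gadget X Y k) × PathVia gadget X Y (4 + M) V

  good-sym : ∀ {X Y} → Good X Y → Good Y X
  good-sym (paths , via) = (λ k 3≤k k≤ → reversePath (paths k 3≤k k≤)) , reversePathVia via

  good-transport : (S : Symmetry) → ∀ u v → Good (encode u) (encode v) →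
                   let open Symmetry S in Good (encode (τ u)) (encode (τ v))
  good-transport S u v (paths , via) =
    subst₂ Good (cong (encode ∘ τ) (decode-encode u)) (cong (encode ∘ τ) (decode-encode v))
      ((λ k 3≤k k≤ → mapPath h (paths k 3≤k k≤)) , subst (PathVia gadget _ _ _) (cong encode fixes-apex) (mapPathVia h via))
    where
    open Symmetry S
    h : Embedding gadget gadget
    h = symmetry⇒embedding S

  good⇒pathPancyclic : (∀ u v → link u v ≡ true → Good (encode u) (encode v)) → PathPancyclic gadget
  good⇒pathPancyclic good {X} {Y} a k =
    subst₂ (λ X Y → 3 ≤ k → k ≤ 5 + M → Path gadget X Y k) (encode-decode X) (encode-decode Y)
      (proj₁ (good (decode X) (decode Y) a) k)

  good⇒almostHamiltonian : (∀ u v → link u v ≡ true → Good (encode u) (encode v)) →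
                           ∀ {X Y} → Adj gadget X Y → PathVia gadget X Y (4 + M) V
  good⇒almostHamiltonian good {X} {Y} a =
    subst₂ (λ X Y → PathVia gadget X Y (4 + M) V) (encode-decode X) (encode-decode Y) (proj₂ (good (decode X) (decode Y) a))

  newPath : ∀ {s t k} (vs : List NewVertex) → {True (isPath? gadget s t k (map (encode ∘ new) vs))} → Path gadget s t k
  newPath vs {ok} = concretePath gadget (map (encode ∘ new) vs) {ok}

  -- Long paths run from o₀ along a path of G to the neighbour a₀ of vertex 0 and come back into
  -- the gadget through the mirror; paths between old vertices make a detour through the gadget.
  module Paths (pancyclic : PathPancyclic G) (almost : ∀ {x y} → Adj G x y → PathVia G x y n zero)
               {a₀} (zero-a₀ : Adj G zero a₀) (3≤n : 3 ≤ n) where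

    M≥3 : 3 ≤ M
    M≥3 = ≤-trans 3≤n (n≤1+n n)

    hamiltonianVia : ∀ {x y} → Adj G x y → PathVia G x y M zero
    hamiltonianVia xy = P , hamiltonianPath-complete P zero
      where
      P : Path G _ _ M
      P = pancyclic xy M M≥3 ≤-refl

    private
      newVs : List NewVertex → List (Fin (5 + M))
      newVs = map (encode ∘ new)

    detour : ∀ {i j k} → Adj G i j → PathVia G i j k zero → (vs : List NewVertex) →
             {ok : True (isPath? gadget C₀ B (length vs) (newVs vs))} →
             PathThrough gadget (encode (orig i)) (encode (orig j)) (length vs + k) (newVs vs)
    detour ij P vs {ok} = insertAt old (adj⇒≢ G ij) P refl (newPath vs {ok}) (λ a → a) (fresh-new vs)

    old-good : ∀ {i j} → Adj G i j → Good (encode (orig i)) (encode (orig j))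
    old-good ij = range-step (range-step (range-step (range-step (range-step direct
                    (around almost seg₂)) (around hamiltonianVia seg₂)) (around hamiltonianVia seg₃))
                    (around hamiltonianVia seg₄)) (around hamiltonianVia seg₅) ,
                  pathThrough⇒pathVia (detour ij (almost ij) seg₅) (there (here refl))
      where
      direct : ∀ k → 3 ≤ k → k ≤ M → Path gadget _ _ k
      direct k 3≤k k≤M = mapPath old (pancyclic ij k 3≤k k≤M)
      seg₂ seg₃ seg₄ seg₅ : List NewVertex
      seg₂ = t₀ ∷ mirror ∷ []
      seg₃ = t₀ ∷ t₁ ∷ mirror ∷ []
      seg₄ = t₀ ∷ apex ∷ t₁ ∷ mirror ∷ []
      seg₅ = t₀ ∷ apex ∷ t₁ ∷ t₂ ∷ mirror ∷ []
      around : ∀ {k} → (∀ {x y} → Adj G x y → PathVia G x y k zero) → (vs : List NewVertex) →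
               {ok : True (isPath? gadget C₀ B (length vs) (newVs vs))} → Path gadget _ _ (length vs + k)
      around P vs {ok} = proj₁ (detour ij (P ij) vs {ok})

    spine : ∀ L → 3 ≤ L → L ≤ M → Path G zero a₀ L
    spine L = pancyclic zero-a₀ L

    throughMirror : ∀ {t} L (3≤L : 3 ≤ L) (L≤M : L ≤ M) (vs : List NewVertex) {ok : True (isPath? gadget B t (length vs) (newVs vs))} →
                    Σ (Path gadget o₀ t (length vs + L)) λ Q → Path.vertices Q ≡ map (encode ∘ orig) (Path.vertices (spine L 3≤L L≤M)) ++ newVs vs
    throughMirror L 3≤L L≤M vs {ok} = appendPath old (spine L 3≤L L≤M) zero-a₀ (newPath vs {ok}) (fresh-new vs)

    fromO₀ : ∀ {t} L → 3 ≤ L → L ≤ M → (vs : List NewVertex) → {ok : True (isPath? gadget B t (length vs) (newVs vs))} →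
             PathThrough gadget o₀ t (length vs + L) (newVs vs)
    fromO₀ L 3≤L L≤M vs {ok} with throughMirror L 3≤L L≤M vs {ok}
    ... | Q , vertices≡ = Q , λ v∈ → subst (_ ∈_) (≡.sym vertices≡) (∈-++⁺ʳ _ v∈)

    fromC₀ : ∀ {t} L → 3 ≤ L → L ≤ M → (vs : List NewVertex) → {ok : True (isPath? gadget B t (length vs) (newVs vs))} →
             {C₀∉ : True (¬? (Any.any? (C₀ ≟_) (newVs vs)))} →
             PathThrough gadget C₀ t (suc (length vs + L)) (newVs vs)
    fromC₀ L 3≤L L≤M vs {ok} {C₀∉} with throughMirror L 3≤L L≤M vs {ok}
    ... | Q , vertices≡ = prependPath refl Q (C₀∉Q ∘ subst (C₀ ∈_) vertices≡) ,
                          λ v∈ → there (subst (_ ∈_) (≡.sym vertices≡) (∈-++⁺ʳ _ v∈))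
      where
      C₀∉Q : C₀ ∉ map (encode ∘ orig) (Path.vertices (spine L 3≤L L≤M)) ++ newVs vs
      C₀∉Q C₀∈ with ∈-++⁻ (map (encode ∘ orig) (Path.vertices (spine L 3≤L L≤M))) C₀∈
      ... | inj₂ C₀∈new = toWitness C₀∉ C₀∈new
      ... | inj₁ C₀∈old with ∈-map⁻ (encode ∘ orig) C₀∈old
      ...   | x , _ , C₀≡x = fresh-new (t₀ ∷ []) (here refl) x C₀≡x

    o₀-C₀ : Good o₀ C₀
    o₀-C₀ = range-step (range-step (range-step (range-join short long ≤-refl) (tail (mirror ∷ t₁ ∷ t₀ ∷ [])))
              (tail (mirror ∷ t₁ ∷ apex ∷ t₀ ∷ []))) (tail (mirror ∷ t₁ ∷ t₂ ∷ apex ∷ t₀ ∷ [])) ,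
            pathThrough⇒pathVia (fromO₀ M M≥3 ≤-refl (mirror ∷ t₁ ∷ apex ∷ t₀ ∷ [])) (there (there (here refl)))
      where
      short : ∀ k → 3 ≤ k → k ≤ 4 → Path gadget o₀ C₀ k
      short = range-step (range-step range-empty (concretePath gadget (o₀ ∷ C₁ ∷ C₀ ∷ [])))
                (concretePath gadget (o₀ ∷ C₁ ∷ V ∷ C₀ ∷ []))
      long : ∀ k → 5 ≤ k → k ≤ 2 + M → Path gadget o₀ C₀ k
      long = range-shift 2 λ L 3≤L L≤M → proj₁ (fromO₀ L 3≤L L≤M (mirror ∷ t₀ ∷ []))
      tail : (vs : List NewVertex) → {ok : True (isPath? gadget B C₀ (length vs) (newVs vs))} → Path gadget o₀ C₀ (length vs + M)
      tail vs {ok} = proj₁ (fromO₀ M M≥3 ≤-refl vs {ok})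

    C₀-C₁ : Good C₀ C₁
    C₀-C₁ = range-step (range-step (range-join short long ≤-refl) (tail (mirror ∷ t₂ ∷ t₁ ∷ [])))
              (tail (mirror ∷ t₂ ∷ apex ∷ t₁ ∷ [])) ,
            pathThrough⇒pathVia (fromC₀ n 3≤n (n≤1+n n) (mirror ∷ t₂ ∷ apex ∷ t₁ ∷ [])) (there (there (here refl)))
      where
      short : ∀ k → 3 ≤ k → k ≤ 5 → Path gadget C₀ C₁ k
      short = range-step (range-step (range-step range-empty (concretePath gadget (C₀ ∷ C₂ ∷ C₁ ∷ [])))
                (concretePath gadget (C₀ ∷ V ∷ C₂ ∷ C₁ ∷ []))) (concretePath gadget (C₀ ∷ o₀ ∷ C₂ ∷ V ∷ C₁ ∷ []))
      long : ∀ k → 6 ≤ k → k ≤ 3 + M → Path gadget C₀ C₁ k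
      long = range-shift 3 λ L 3≤L L≤M → proj₁ (fromC₀ L 3≤L L≤M (mirror ∷ t₁ ∷ []))
      tail : (vs : List NewVertex) → {ok : True (isPath? gadget B C₁ (length vs) (newVs vs))} →
             {C₀∉ : True (¬? (Any.any? (C₀ ≟_) (newVs vs)))} → Path gadget C₀ C₁ (suc (length vs + M))
      tail vs {ok} {C₀∉} = proj₁ (fromC₀ M M≥3 ≤-refl vs {ok} {C₀∉})

    C₀-V : Good C₀ V
    C₀-V = range-step (range-join short long ≤-refl) (tail (mirror ∷ t₁ ∷ t₂ ∷ apex ∷ [])) ,
           pathThrough⇒pathVia (fromC₀ M M≥3 ≤-refl (mirror ∷ t₁ ∷ apex ∷ [])) (there (there (here refl)))
      where
      short : ∀ k → 3 ≤ k → k ≤ 6 → Path gadget C₀ V k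
      short = range-step (range-step (range-step (range-step range-empty (concretePath gadget (C₀ ∷ C₁ ∷ V ∷ [])))
                (concretePath gadget (C₀ ∷ C₂ ∷ C₁ ∷ V ∷ []))) (concretePath gadget (C₀ ∷ o₀ ∷ C₂ ∷ C₁ ∷ V ∷ [])))
                (concretePath gadget (C₀ ∷ o₀ ∷ C₂ ∷ B ∷ C₁ ∷ V ∷ []))
      long : ∀ k → 7 ≤ k → k ≤ 4 + M → Path gadget C₀ V k
      long = range-shift 4 λ L 3≤L L≤M → proj₁ (fromC₀ L 3≤L L≤M (mirror ∷ t₁ ∷ apex ∷ []))
      tail : (vs : List NewVertex) → {ok : True (isPath? gadget B V (length vs) (newVs vs))} →
             {C₀∉ : True (¬? (Any.any? (C₀ ≟_) (newVs vs)))} → Path gadget C₀ V (suc (length vs + M))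
      tail vs {ok} {C₀∉} = proj₁ (fromC₀ M M≥3 ≤-refl vs {ok} {C₀∉})

    o₀-tri : ∀ x → Good o₀ (C x)
    o₀-tri zero = o₀-C₀
    o₀-tri (suc zero) = good-transport (relabel zero (suc zero)) (orig zero) (new t₀) o₀-C₀
    o₀-tri (suc (suc zero)) = good-transport (relabel zero (suc (suc zero))) (orig zero) (new t₀) o₀-C₀

    tri-V : ∀ x → Good (C x) V
    tri-V zero = C₀-V
    tri-V (suc zero) = good-transport (relabel zero (suc zero)) (new t₀) (new apex) C₀-V
    tri-V (suc (suc zero)) = good-transport (relabel zero (suc (suc zero))) (new t₀) (new apex) C₀-V

    tri-tri : ∀ x y → not (does (x ≟ y)) ≡ true → Good (C x) (C y)
    tri-tri zero (suc zero) _ = C₀-C₁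
    tri-tri (suc zero) zero _ = good-sym C₀-C₁
    tri-tri zero (suc (suc zero)) _ = good-transport (relabel (suc zero) (suc (suc zero))) (new t₀) (new t₁) C₀-C₁
    tri-tri (suc (suc zero)) zero _ = good-sym (good-transport (relabel (suc zero) (suc (suc zero))) (new t₀) (new t₁) C₀-C₁)
    tri-tri (suc (suc zero)) (suc zero) _ = good-transport (relabel zero (suc (suc zero))) (new t₀) (new t₁) C₀-C₁
    tri-tri (suc zero) (suc (suc zero)) _ = good-sym (good-transport (relabel zero (suc (suc zero))) (new t₀) (new t₁) C₀-C₁)
    tri-tri zero zero ()
    tri-tri (suc zero) (suc zero) ()
    tri-tri (suc (suc zero)) (suc (suc zero)) ()

    good : ∀ u v → link u v ≡ true → Good (encode u) (encode v)
    good (orig i)        (orig j)        ij = old-good ij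
    good (new mirror)    (orig zero)     a  = ⊥-elim (adj-irrefl G a)
    good (new mirror)    (orig (suc j))  a  = good-transport swapMirror (orig zero) (orig (suc j)) (old-good a)
    good (orig zero)     (new mirror)    a  = ⊥-elim (adj-irrefl G a)
    good (orig (suc i))  (new mirror)    a  = good-sym (good-transport swapMirror (orig zero) (orig (suc i)) (old-good a))
    good (orig zero)     (new (tri x))   _  = o₀-tri x
    good (new (tri x))   (orig zero)     _  = good-sym (o₀-tri x)
    good (orig (suc _))  (new (tri _))   ()
    good (new (tri _))   (orig (suc _))  ()
    good (new mirror)    (new (tri x))   _  = good-transport swapMirror (orig zero) (new (tri x)) (o₀-tri x)
    good (new (tri x))   (new mirror)    _  = good-sym (good-transport swapMirror (orig zero) (new (tri x)) (o₀-tri x))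
    good (new (tri x))   (new (tri y))   a  = tri-tri x y a
    good (new (tri x))   (new apex)      _  = tri-V x
    good (new apex)      (new (tri x))   _  = good-sym (tri-V x)

    gadget-pathPancyclic : PathPancyclic gadget
    gadget-pathPancyclic = good⇒pathPancyclic good

    gadget-almostHamiltonian : ∀ {X Y} → Adj gadget X Y → PathVia gadget X Y (4 + M) zero
    gadget-almostHamiltonian = good⇒almostHamiltonian good

  module _ {d} (W : DiameterWitness G d zero) where
    open DiameterWitness W

    toC₀ : ∀ v → WalkWithin gadget 1 (encode (new v)) C₀
    toC₀ apex                   = 1 , ≤-refl , refl ∷ []
    toC₀ (tri zero)             = 0 , z≤n , []
    toC₀ (tri (suc zero))       = 1 , ≤-refl , refl ∷ []
    toC₀ (tri (suc (suc zero))) = 1 , ≤-refl , refl ∷ []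
    toC₀ mirror                 = 1 , ≤-refl , refl ∷ []

    new-near-old : ∀ v j → WalkWithin gadget (2 + d) (encode (new v)) (encode (orig j))
    new-near-old v j with toC₀ v | near zero j
    ... | ℓ₁ , ℓ₁≤1 , w₁ | ℓ₂ , ℓ₂≤d , w₂ =
      ℓ₁ + suc ℓ₂ , +-mono-≤ ℓ₁≤1 (s≤s ℓ₂≤d) , walk′-++ w₁ (refl ∷ walk′-map old w₂)

    new-near-new : ∀ v w → WalkWithin gadget (2 + d) (encode (new v)) (encode (new w))
    new-near-new v w with toC₀ v | toC₀ w
    ... | ℓ₁ , ℓ₁≤1 , w₁ | ℓ₂ , ℓ₂≤1 , w₂ =
      ℓ₁ + ℓ₂ , ≤-trans (+-mono-≤ ℓ₁≤1 ℓ₂≤1) (s≤s (s≤s z≤n)) , walk′-++ w₁ (walk′-reverse w₂)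

    near-encoded : ∀ u v → WalkWithin gadget (2 + d) (encode u) (encode v)
    near-encoded (new v)  (new w)  = new-near-new v w
    near-encoded (new v)  (orig j) = new-near-old v j
    near-encoded (orig i) (new w)  = walkWithin-reverse (new-near-old w i)
    near-encoded (orig i) (orig j) with near i j
    ... | ℓ , ℓ≤d , w = ℓ , ≤-trans ℓ≤d (≤-trans (n≤1+n d) (n≤1+n (suc d))) , walk′-map old w

    gadget-height : Vertex → ℕ
    gadget-height (orig i)      = height i
    gadget-height (new mirror)  = height zero
    gadget-height (new (tri _)) = suc (height zero)
    gadget-height (new apex)    = suc (suc (height zero))

    gadget-height-lipschitz : ∀ u v → link u v ≡ true → gadget-height u ≤ suc (gadget-height v)
    gadget-height-lipschitz (orig i)      (orig j)      a = lipschitz a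
    gadget-height-lipschitz (orig i)      (new mirror)  a = lipschitz (adj-sym G a)
    gadget-height-lipschitz (new mirror)  (orig j)      a = lipschitz a
    gadget-height-lipschitz (orig zero)   (new (tri _)) _ = ≤-trans (n≤1+n _) (n≤1+n _)
    gadget-height-lipschitz (new (tri _)) (orig zero)   _ = ≤-refl
    gadget-height-lipschitz (new mirror)  (new (tri _)) _ = ≤-trans (n≤1+n _) (n≤1+n _)
    gadget-height-lipschitz (new (tri _)) (new mirror)  _ = ≤-refl
    gadget-height-lipschitz (new (tri _)) (new (tri _)) _ = n≤1+n _
    gadget-height-lipschitz (new (tri _)) (new apex)    _ = ≤-trans (n≤1+n _) (n≤1+n _)
    gadget-height-lipschitz (new apex)    (new (tri _)) _ = ≤-refl

    gadget-diameter : DiameterWitness gadget (2 + d) zero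
    gadget-diameter = record
      { near = λ X Y → subst₂ (WalkWithin gadget (2 + d)) (encode-decode X) (encode-decode Y) (near-encoded (decode X) (decode Y))
      ; height = gadget-height ∘ decode
      ; lipschitz = λ {X} {Y} → gadget-height-lipschitz (decode X) (decode Y)
      ; bottom = encode (orig bottom)
      ; tall = ≤-trans (≤-reflexive (≡.trans (+-suc (height bottom) (suc d)) (cong suc (+-suc (height bottom) d)))) (s≤s (s≤s tall)) }

-- The paths through vertex 0 that miss one vertex yield the detours of lengths n + 2 and n + 5
-- through the gadget, and the gadget reproduces them for its own vertex 0, the apex.
record GadgetSeed (n d : ℕ) : Set where
  field
    graph             : Graph (suc n)
    pancyclic         : PathPancyclic graph
    almostHamiltonian : ∀ {x y} → Adj graph x y → PathVia graph x y n zero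
    a₀                : Fin (suc n)
    zero-a₀           : Adj graph zero a₀
    3≤n               : 3 ≤ n
    diameter          : DiameterWitness graph d zero

attachGadget : ∀ {n d} → GadgetSeed n d → GadgetSeed (5 + n) (2 + d)
attachGadget S = record
  { graph = gadget ; pancyclic = gadget-pathPancyclic ; almostHamiltonian = gadget-almostHamiltonian
  ; a₀ = C₀ ; zero-a₀ = refl ; 3≤n = ≤-trans 3≤n (m≤n+m _ 5) ; diameter = gadget-diameter diameter }
  where
  open GadgetSeed S
  open Gadget graph
  open Paths pancyclic almostHamiltonian zero-a₀ 3≤n

gadgetSeed⇒realisation : ∀ {n d} → GadgetSeed n d → Realisation (suc n) d
gadgetSeed⇒realisation S = record
  { graph = graph ; pancyclic = pancyclic ; hub = zero ; spoke = a₀ ; hub-spoke = zero-a₀ ; top = zero ; diameter = diameter }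
  where open GadgetSeed S

-- The extremal graphs

K₃-neighbours : Fin 3 → List (Fin 3)
K₃-neighbours = lookup ((# 1 ∷ # 2 ∷ []) ∷ (# 0 ∷ # 2 ∷ []) ∷ (# 0 ∷ # 1 ∷ []) ∷ [])

K₅-minus-edge-neighbours : Fin 5 → List (Fin 5)
K₅-minus-edge-neighbours = lookup ((# 1 ∷ # 2 ∷ # 3 ∷ []) ∷ (# 0 ∷ # 2 ∷ # 3 ∷ # 4 ∷ []) ∷ (# 0 ∷ # 1 ∷ # 3 ∷ # 4 ∷ []) ∷
                                   (# 0 ∷ # 1 ∷ # 2 ∷ # 4 ∷ []) ∷ (# 1 ∷ # 2 ∷ # 3 ∷ []) ∷ [])

eightVertex-neighbours : Fin 8 → List (Fin 8)
eightVertex-neighbours = lookup ((# 1 ∷ # 2 ∷ # 3 ∷ []) ∷ (# 0 ∷ # 2 ∷ # 5 ∷ # 6 ∷ []) ∷ (# 0 ∷ # 1 ∷ # 3 ∷ # 4 ∷ []) ∷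
                                 (# 0 ∷ # 2 ∷ # 4 ∷ []) ∷ (# 2 ∷ # 3 ∷ # 5 ∷ # 7 ∷ []) ∷ (# 1 ∷ # 4 ∷ # 6 ∷ # 7 ∷ []) ∷
                                 (# 1 ∷ # 5 ∷ # 7 ∷ []) ∷ (# 4 ∷ # 5 ∷ # 6 ∷ []) ∷ [])

K₃ : Graph 3
K₃ = fromNeighbours K₃-neighbours

K₅-minus-edge : Graph 5
K₅-minus-edge = fromNeighbours K₅-minus-edge-neighbours

eightVertexGraph : Graph 8
eightVertexGraph = fromNeighbours eightVertex-neighbours

K₃-realisation : Realisation 3 1
K₃-realisation = record
  { graph = K₃ ; pancyclic = searched-pathPancyclic _ ; hub = # 0 ; spoke = # 1 ; hub-spoke = refl
  ; top = # 0 ; diameter = checked-diameter 1 (lookup (1 ∷ 0 ∷ 1 ∷ [])) (# 0) (# 1) _ _ _ }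
  where open Search K₃ K₃-neighbours

K₅-minus-edge-seed : GadgetSeed 4 2
K₅-minus-edge-seed = record
  { graph = K₅-minus-edge ; pancyclic = searched-pathPancyclic _ ; almostHamiltonian = searched-pathVia _
  ; a₀ = # 1 ; zero-a₀ = refl ; 3≤n = s≤s (s≤s (s≤s z≤n))
  ; diameter = checked-diameter 2 (lookup (2 ∷ 1 ∷ 1 ∷ 1 ∷ 0 ∷ [])) (# 0) (# 4) _ _ _ }
  where open Search K₅-minus-edge K₅-minus-edge-neighbours

eightVertex-seed : GadgetSeed 7 3
eightVertex-seed = record
  { graph = eightVertexGraph ; pancyclic = searched-pathPancyclic _ ; almostHamiltonian = searched-pathVia _
  ; a₀ = # 1 ; zero-a₀ = refl ; 3≤n = s≤s (s≤s (s≤s z≤n))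
  ; diameter = checked-diameter 3 (lookup (3 ∷ 2 ∷ 2 ∷ 2 ∷ 1 ∷ 1 ∷ 1 ∷ 0 ∷ [])) (# 0) (# 7) _ _ _ }
  where open Search eightVertexGraph eightVertex-neighbours

seedOrder : ℕ → ℕ
seedOrder zero = 4
seedOrder (suc zero) = 7
seedOrder (suc (suc d)) = 5 + seedOrder d

seed : ∀ d → GadgetSeed (seedOrder d) (2 + d)
seed zero = K₅-minus-edge-seed
seed (suc zero) = eightVertex-seed
seed (suc (suc d)) = attachGadget (seed d)

seedOrder-bound : ∀ d → 2 * suc (seedOrder d) ≤ suc (5 * (2 + d))
seedOrder-bound zero = n≤1+n 10
seedOrder-bound (suc zero) = ≤-refl
seedOrder-bound (suc (suc d)) = subst₂ _≤_ (lhs (seedOrder d)) (rhs d) (+-monoʳ-≤ 10 (seedOrder-bound d))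
  where
  lhs : ∀ s → 10 + 2 * suc s ≡ 2 * suc (5 + s)
  lhs = solve 1 (λ s → con 10 :+ con 2 :* (con 1 :+ s) := con 2 :* (con 6 :+ s)) refl
  rhs : ∀ d → 10 + suc (5 * (2 + d)) ≡ suc (5 * (4 + d))
  rhs = solve 1 (λ d → con 10 :+ (con 1 :+ con 5 :* (con 2 :+ d)) := con 1 :+ con 5 :* (con 4 :+ d)) refl

realise : ∀ {d N} → 1 ≤ d → 5 * d ≤ 2 * N → Realisation N d
realise {suc zero} {N} _ 5≤2N = grow ≤-refl ≤-refl K₃-realisation (half-≤ 3 N (s≤s 5≤2N))
realise {suc (suc d)} {N} _ 5d≤2N =
  grow (≤-trans (GadgetSeed.3≤n (seed d)) (n≤1+n _)) (s≤s z≤n) (gadgetSeed⇒realisation (seed d))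
       (half-≤ (suc (seedOrder d)) N (≤-trans (seedOrder-bound d) (s≤s 5d≤2N)))

theorem6 : ∀ (n : ℕ) → 3 ≤ n →
    (∀ (G : Graph n) → EdgePancyclic G → HasEdge G →
    Σ ℕ λ D → HasDiameter G D × D ≤ (2 * n) / 5)
    × (Σ (Graph n) λ G → EdgePancyclic G × HasEdge G × HasDiameter G ((2 * n) / 5))
theorem6 n 3≤n = upper , Realisation.graph R , realisation⇒extremal R
  where
  upper : ∀ G → EdgePancyclic G → HasEdge G → Σ ℕ λ D → HasDiameter G D × D ≤ (2 * n) / 5
  upper G ep (u , v , uv) = D , hasDiameter , diameter≤2n/5
    where open UpperBound (edgePancyclic⇒pathPancyclic ep) 3≤n uv
  R : Realisation n ((2 * n) / 5)
  R = realise (m≥n⇒m/n>0 (≤-trans (n≤1+n 5) (*-monoʳ-≤ 2 3≤n))) (subst (_≤ 2 * n) (*-comm ((2 * n) / 5) 5) (m/n*n≤m (2 * n) 5))
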